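{- Let $X$ be a finite pure $d$-dimensional simplicial complex, $0\le i<d$, and $0<\eta<1$. Then for every $i$-cochain $W\subseteq X(i)$ with $\|W\|<\eta^{2^{i+1}-1}$ and every real $c\le 1/2$, there exists $0\le j\le i$ such that $$\Pr\big[P_j\in S^j(W)\ \wedge\ P_{j-1}\notin S^{j-1}(W)\big]\ge\frac{c^j}{i+1}\|W\|.$$
   Context: A simplicial complex $X$ on a finite vertex set is a family of subsets (faces) closed under taking subsets; it contains $\emptyset$. A face $\sigma$ has dimension $|\sigma|-1$; $X(i)$ is the set of $i$-faces, $X(-1)=\{\emptyset\}$. $X$ is $d$-dimensional if its maximal face dimension is $d$, pure if every face lies in a $d$-face. $\deg(\sigma)$ is the number of $d$-faces containing $\sigma$. For $W\subseteq X(i)$, $\|W\|=\sum_{\sigma\in W}\deg(\sigma)/\sum_{\tau\in X(i)}\deg(\tau)$. Random faces: let $P_d$ be a uniformly random $d$-face, and for $k=d-1,\dots,-1$ let $P_k$ be obtained from $P_{k+1}$ by deleting a uniformly random vertex (independently); then $\|W\|=\Pr[P_i\in W]$. The link of $\sigma$ is $X_\sigma=\{\tau\setminus\sigma:\tau\in X,\tau\supseteq\sigma\}$, and $\|\cdot\|_\sigma$ is the norm computed in $X_\sigma$ (degrees = numbers of top faces of $X_\sigma$). For $U\subseteq X(k)$ and a face $\sigma$ of dimension $<k$, the localization is $U_\sigma=\{\tau\in X_\sigma:\tau\sqcup\sigma\in U\}$ (disjoint union); note $\|U_\sigma\|_\sigma=\Pr[P_k\in U\mid P_{\dim\sigma}=\sigma]$.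 Fat faces (with fatness constant $\eta$): $S^i(W)=W$ and, for $-1\le j<i$, $S^j(W)=\{\sigma\in X(j):\|S^{j+1}(W)_\sigma\|_\sigma\ge\eta^{2^{i-j-1}}\}$. The convention $c^0=1$ is used.
   Formalization: The fatness constant η and the constant c range over the rationals instead of the reals. -}

module Defs where

open import Data.Bool using (Bool; true; false; _∧_; _∨_; not; if_then_else_)
open import Data.Nat as ℕ using (ℕ; zero; suc; _∸_; _⊔_)
open import Data.Fin using (Fin; zero; suc)
open import Data.Vec using (Vec; []; _∷_)
open import Data.List using (List; []; _∷_; _++_; map; filter; foldr; length)
open import Data.Fin.Subset using (Subset; Side; inside; outside; ∣_∣; _∪_; _-_)
open import Data.Integer using (+_)
open import Data.Rational as ℚ using (ℚ; 0ℚ; 1ℚ; _*_; _+_)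
open import Relation.Binary.PropositionalEquality using (_≡_)
open import Data.Product using (Σ; _×_)
import Data.Bool as Bool
import Data.Fin.Subset

allSubsets : (n : ℕ) → List (Subset n)
allSubsets zero    = [] ∷ []
allSubsets (suc n) = map (inside ∷_) (allSubsets n) ++ map (outside ∷_) (allSubsets n)

vertices : ∀ {n} → Subset n → List (Fin n)
vertices []            = []
vertices (inside ∷ p)  = zero ∷ map suc (vertices p)
vertices (outside ∷ p) = map suc (vertices p)

_⊆ᵇ_ : ∀ {n} → Subset n → Subset n → Bool
[]            ⊆ᵇ []            = true
(outside ∷ p) ⊆ᵇ (_ ∷ q)       = p ⊆ᵇ q
(inside ∷ p)  ⊆ᵇ (inside ∷ q)  = p ⊆ᵇ q
(inside ∷ p)  ⊆ᵇ (outside ∷ q) = false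

disjointᵇ : ∀ {n} → Subset n → Subset n → Bool
disjointᵇ []            []            = true
disjointᵇ (inside ∷ p)  (inside ∷ q)  = false
disjointᵇ (inside ∷ p)  (outside ∷ q) = disjointᵇ p q
disjointᵇ (outside ∷ p) (_ ∷ q)       = disjointᵇ p q

sumℕ : List ℕ → ℕ
sumℕ = foldr ℕ._+_ 0

sumℚ : List ℚ → ℚ
sumℚ = foldr _+_ 0ℚ

count : ∀ {n} → (Subset n → Bool) → ℕ
count {n} P = length (filter (λ σ → P σ Bool.≟ true) (allSubsets n))

ΣS : ∀ {n} → (Subset n → Bool) → (Subset n → ℕ) → ℕ
ΣS {n} P f = sumℕ (map (λ σ → if P σ then f σ else 0) (allSubsets n))

-- a / b as a rational, with the convention a / 0 = 0
frac : ℕ → ℕ → ℚ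
frac a zero    = 0ℚ
frac a (suc b) = (+ a) ℚ./ suc b

_^ℚ_ : ℚ → ℕ → ℚ
q ^ℚ zero  = 1ℚ
q ^ℚ suc k = q * (q ^ℚ k)

-- Simplicial complexes on the vertex set Fin n, given as decidable
-- families of subsets.  Faces are measured by their SIZE = dimension + 1.

Family : ℕ → Set
Family n = Subset n → Bool

IsSimplicialComplex : ∀ {n} → Family n → Set
IsSimplicialComplex {n} X =
  (X Data.Fin.Subset.⊥ ≡ true) ×
  (∀ (σ τ : Subset n) → (τ ⊆ᵇ σ) ≡ true → X σ ≡ true → X τ ≡ true)

IsDimensional : ∀ {n} → Family n → ℕ → Set
IsDimensional {n} X d =
  (Σ (Subset n) λ σ → (X σ ≡ true) × (∣ σ ∣ ≡ suc d)) ×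
  (∀ (σ : Subset n) → X σ ≡ true → ∣ σ ∣ ℕ.≤ suc d)

IsPure : ∀ {n} → Family n → ℕ → Set
IsPure {n} X d =
  ∀ (σ : Subset n) → X σ ≡ true →
    Σ (Subset n) λ τ → (X τ ≡ true) × (∣ τ ∣ ≡ suc d) × ((σ ⊆ᵇ τ) ≡ true)

level : ∀ {n} → Family n → ℕ → Family n
level X s σ = X σ ∧ (∣ σ ∣ ℕ.≡ᵇ s)

topSize : ∀ {n} → Family n → ℕ
topSize {n} Y = foldr _⊔_ 0 (map (λ σ → if Y σ then ∣ σ ∣ else 0) (allSubsets n))

deg : ∀ {n} → Family n → Subset n → ℕ
deg Y σ = count (λ τ → level Y (topSize Y) τ ∧ (σ ⊆ᵇ τ))

norm : ∀ {n} → Family n → ℕ → Family n → ℚ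
norm Y s W = frac (ΣS (λ σ → level Y s σ ∧ W σ) (deg Y)) (ΣS (level Y s) (deg Y))

-- the link X_σ = {τ ∖ σ : τ ∈ X, τ ⊇ σ}, i.e. faces τ disjoint from σ with τ ∪ σ ∈ X
link : ∀ {n} → Family n → Subset n → Family n
link X σ τ = disjointᵇ τ σ ∧ X (τ ∪ σ)

localize : ∀ {n} → Family n → Family n → Subset n → Family n
localize X U σ τ = link X σ τ ∧ U (τ ∪ σ)

localNorm : ∀ {n} → Family n → ℕ → Family n → Subset n → ℚ
localNorm X s U σ = norm (link X σ) (s ∸ ∣ σ ∣) (localize X U σ)

-- For W ⊆ X(i) (faces of size i+1), fat X η i W t is S^{i-t}(W):
--   fat 0 = W = S^i(W)
--   fat (t+1) = S^{i-t-1}(W) = {σ ∈ X(i-t-1) : ‖S^{i-t}(W)_σ‖_σ ≥ η^(2^t)}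
-- (exponent 2^{i-j-1} with j = i-t-1 equals 2^t).

fat : ∀ {n} → Family n → ℚ → ℕ → Family n → ℕ → Family n
fat X η i W zero    = W
fat X η i W (suc t) σ =
  level X (i ∸ t) σ ∧ ((η ^ℚ (2 ℕ.^ t)) ℚ.≤ᵇ localNorm X (suc i ∸ t) (fat X η i W t) σ)

-- S^j(W) for W ⊆ X(i), 0 ≤ j+1 ≤ i+1; here indexed by the size s = j+1
-- of its faces, so S X η i W s = S^{s-1}(W).
S : ∀ {n} → Family n → ℚ → ℕ → Family n → ℕ → Family n
S X η i W s = fat X η i W (suc i ∸ s)

single : ∀ {n} → Subset n → Family n
single σ τ = (τ ⊆ᵇ σ) ∧ (σ ⊆ᵇ τ)

-- Pr[P_{s-1} = σ] = ‖{σ}‖ (for faces of size s), and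
-- Pr[P_{s-1} ∈ A ∧ P_{s-2} ∉ B]
--   = Σ_{σ ∈ A ∩ X(s-1)} Pr[P_{s-1} = σ] · #{v ∈ σ : σ ∖ v ∉ B} / s
-- since P_{s-2} is P_{s-1} with a uniformly random vertex deleted.
-- (Used with s = j + 1 ≥ 1.)
jointProb : ∀ {n} → Family n → ℕ → Family n → Family n → ℚ
jointProb X s A B =
  sumℚ (map (λ σ → if level X s σ ∧ A σ
                     then norm X s (single σ) *
                          frac (length (filter (λ v → not (B (σ - v)) Bool.≟ true) (vertices σ))) s
                     else 0ℚ)
            (allSubsets _))

{-# OPTIONS --safe #-}
module Submission where

-- Let m_j = Pr[P_j ∈ S^j(W)] and e_j = Pr[P_j ∈ S^j(W) ∧ P_{j-1} ∉ S^{j-1}(W)].  Averaging the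
-- defining inequality of S^{j-1}(W) over its faces is a Markov bound η^{2^{i-j}} m_{j-1} ≤ m_j,
-- and splitting on whether P_{j-1} ∈ S^{j-1}(W) gives m_j ≤ e_j + m_{j-1}.
-- As P_{-1} = ∅, m_{-1} is 0 or 1, and chaining the first bound rules out 1 since
-- ‖W‖ = m_i < η^{2^{i+1}-1}.  So ‖W‖ ≤ e_0 + … + e_i and some e_j is at least ‖W‖/(i+1).
-- All these probabilities are quotients of sums of degrees.  With D = d + 1 one has
-- (r+1) Σ_{|σ|=r+1} deg σ = (D-r) Σ_{|τ|=r} deg τ, so scaling the size-s quantities by s!(D-s)!
-- gives them a common denominator and the estimates are carried out on natural numbers.

open import Defs

module Counting where

  import Data.Bool as Bool
  open import Data.Bool using (Bool; true; false; _∧_; not; if_then_else_; T)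
  open import Data.Bool.Properties using (∧-zeroʳ; ∧-identityʳ; ∧-conicalˡ; ∧-conicalʳ)
  open import Data.Nat using (ℕ; zero; suc; _+_; _*_; _∸_; _≤_; _⊔_; _≡ᵇ_; _!; z≤n)
  open import Data.Nat.Properties
  open import Data.Nat.ListAction.Properties using (sum-++)
  open import Data.Fin using (Fin; zero; suc)
  open import Data.Vec using ([]; _∷_; lookup)
  open import Data.List using (List; []; _∷_; _++_; map; filter; foldr; length)
  open import Data.List.Properties using (map-++; map-∘; foldr-preservesᵇ; foldr-preservesᵒ)
  open import Data.List.Membership.Propositional using (_∈_)
  open import Data.List.Membership.Propositional.Properties using (∈-++⁺ˡ; ∈-++⁺ʳ; ∈-map⁺)
  open import Data.List.Relation.Unary.All using (universal)
  import Data.List.Relation.Unary.All.Properties as Allₚ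
  open import Data.List.Relation.Unary.Any using (here)
  import Data.List.Relation.Unary.Any as Any
  import Data.List.Relation.Unary.Any.Properties as Anyₚ
  open import Data.Fin.Subset using (Subset; ⁅_⁆; _∪_; _─_; _-_; ∣_∣; inside; outside; ⊥)
  open import Data.Fin.Subset.Properties using (∪-identityˡ; p─⊥≡p)
  open import Data.Sum using ([_,_]; inj₂)
  open import Algebra.Properties.Semiring.Sum +-*-semiring
    using (sum; sum-syntax; sum-cong-≗; sum-replicate-zero; ∑-distrib-+; *-distribˡ-sum)
  open import Algebra.Properties.CommutativeSemigroup +-commutativeSemigroup using (interchange)
  open import Algebra.Properties.CommutativeSemigroup *-commutativeSemigroup
    using () renaming (x∙yz≈y∙xz to x*[y*z]≡y*[x*z]; x∙yz≈yx∙z to x*[y*z]≡[y*x]*z; xy∙z≈y∙xz to [x*y]*z≡y*[x*z])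
  open import Function using (_∘_)
  open import Relation.Binary.PropositionalEquality

  infixr 8 _?·_

  _?·_ : Bool → ℕ → ℕ
  b ?· x = if b then x else 0

  𝟙 : Bool → ℕ
  𝟙 b = b ?· 1

  ?·-≤ : ∀ b x → b ?· x ≤ x
  ?·-≤ true  x = ≤-refl
  ?·-≤ false x = z≤n

  ?·-monoʳ-≤ : ∀ b {x y} → x ≤ y → b ?· x ≤ b ?· y
  ?·-monoʳ-≤ true  x≤y = x≤y
  ?·-monoʳ-≤ false _   = z≤n

  ∧-?·-comm : ∀ a b x → (a ∧ b) ?· x ≡ b ?· a ?· x
  ∧-?·-comm true  true  x = refl
  ∧-?·-comm true  false x = refl
  ∧-?·-comm false true  x = refl
  ∧-?·-comm false false x = refl

  ?·-distrib-+ : ∀ b {x y} → b ?· (x + y) ≡ b ?· x + b ?· y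
  ?·-distrib-+ true  = refl
  ?·-distrib-+ false = refl

  ?·-zeroʳ : ∀ b → b ?· 0 ≡ 0
  ?·-zeroʳ true  = refl
  ?·-zeroʳ false = refl

  ≡ᵇ-true⇒≡ : ∀ {m n} → (m ≡ᵇ n) ≡ true → m ≡ n
  ≡ᵇ-true⇒≡ {m} {n} m≡ᵇn = ≡ᵇ⇒≡ m n (subst T (sym m≡ᵇn) _)

  ≡ᵇ-refl : ∀ m → (m ≡ᵇ m) ≡ true
  ≡ᵇ-refl zero    = refl
  ≡ᵇ-refl (suc m) = ≡ᵇ-refl m

  ≡ᵇ-+-cancelʳ : ∀ a b c → (a + c ≡ᵇ b + c) ≡ (a ≡ᵇ b)
  ≡ᵇ-+-cancelʳ a b c rewrite +-comm a c | +-comm b c = cancel c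
    where
    cancel : ∀ c → (c + a ≡ᵇ c + b) ≡ (a ≡ᵇ b)
    cancel zero    = refl
    cancel (suc c) = cancel c

  ∑-mono-≤ : ∀ {n} {f g : Fin n → ℕ} → (∀ v → f v ≤ g v) → sum f ≤ sum g
  ∑-mono-≤ {zero}  f≤g = z≤n
  ∑-mono-≤ {suc n} f≤g = +-mono-≤ (f≤g zero) (∑-mono-≤ (f≤g ∘ suc))

  ∑-zero : ∀ {n} {f : Fin n → ℕ} → (∀ v → f v ≡ 0) → sum f ≡ 0
  ∑-zero {n} f≗0 = trans (sum-cong-≗ f≗0) (sum-replicate-zero n)

  ?·-distrib-∑ : ∀ {n} b (f : Fin n → ℕ) → b ?· sum f ≡ ∑[ v < n ] (b ?· f v)
  ?·-distrib-∑ true  f = refl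
  ?·-distrib-∑ {n} false f = sym (∑-zero {n} {λ _ → 0} (λ _ → refl))

  ∑-lookup-?· : ∀ {n} (σ : Subset n) k → ∑[ v < n ] (lookup σ v ?· k) ≡ ∣ σ ∣ * k
  ∑-lookup-?· []            k = refl
  ∑-lookup-?· (inside ∷ σ)  k = cong (k +_) (∑-lookup-?· σ k)
  ∑-lookup-?· (outside ∷ σ) k = ∑-lookup-?· σ k

  ∑-𝟙-lookup : ∀ {n} (σ : Subset n) → ∑[ v < n ] 𝟙 (lookup σ v) ≡ ∣ σ ∣
  ∑-𝟙-lookup σ = trans (∑-lookup-?· σ 1) (*-identityʳ ∣ σ ∣)

  Σˢ : ∀ {n} → (Subset n → ℕ) → ℕ
  Σˢ {zero}  f = f []
  Σˢ {suc n} f = Σˢ (f ∘ (inside ∷_)) + Σˢ (f ∘ (outside ∷_))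

  Σˢ-cong : ∀ {n} {f g : Subset n → ℕ} → (∀ p → f p ≡ g p) → Σˢ f ≡ Σˢ g
  Σˢ-cong {zero}  f≗g = f≗g []
  Σˢ-cong {suc n} f≗g = cong₂ _+_ (Σˢ-cong (f≗g ∘ (inside ∷_))) (Σˢ-cong (f≗g ∘ (outside ∷_)))

  Σˢ-mono-≤ : ∀ {n} {f g : Subset n → ℕ} → (∀ p → f p ≤ g p) → Σˢ f ≤ Σˢ g
  Σˢ-mono-≤ {zero}  f≤g = f≤g []
  Σˢ-mono-≤ {suc n} f≤g = +-mono-≤ (Σˢ-mono-≤ (f≤g ∘ (inside ∷_))) (Σˢ-mono-≤ (f≤g ∘ (outside ∷_)))

  Σˢ-zero : ∀ {n} {f : Subset n → ℕ} → (∀ p → f p ≡ 0) → Σˢ f ≡ 0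
  Σˢ-zero {zero}  f≗0 = f≗0 []
  Σˢ-zero {suc n} f≗0 = cong₂ _+_ (Σˢ-zero (f≗0 ∘ (inside ∷_))) (Σˢ-zero (f≗0 ∘ (outside ∷_)))

  Σˢ-distrib-+ : ∀ {n} (f g : Subset n → ℕ) → Σˢ (λ p → f p + g p) ≡ Σˢ f + Σˢ g
  Σˢ-distrib-+ {zero}  f g = refl
  Σˢ-distrib-+ {suc n} f g = trans
    (cong₂ _+_ (Σˢ-distrib-+ (f ∘ (inside ∷_)) (g ∘ (inside ∷_))) (Σˢ-distrib-+ (f ∘ (outside ∷_)) (g ∘ (outside ∷_))))
    (interchange (Σˢ (f ∘ (inside ∷_))) _ _ _)

  *-distribˡ-Σˢ : ∀ {n} k (f : Subset n → ℕ) → k * Σˢ f ≡ Σˢ (λ p → k * f p)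
  *-distribˡ-Σˢ {zero}  k f = refl
  *-distribˡ-Σˢ {suc n} k f = trans (*-distribˡ-+ k _ _)
    (cong₂ _+_ (*-distribˡ-Σˢ k (f ∘ (inside ∷_))) (*-distribˡ-Σˢ k (f ∘ (outside ∷_))))

  ?·-distrib-Σˢ : ∀ {n} b (f : Subset n → ℕ) → b ?· Σˢ f ≡ Σˢ (λ p → b ?· f p)
  ?·-distrib-Σˢ true  f = refl
  ?·-distrib-Σˢ {n} false f = sym (Σˢ-zero {n} (λ _ → refl))

  Σˢ-?·-≡-* : ∀ {n} (A : Subset n → Bool) {f g : Subset n → ℕ} k →
    (∀ σ → A σ ≡ true → f σ ≡ k * g σ) → Σˢ (λ σ → A σ ?· f σ) ≡ k * Σˢ (λ σ → A σ ?· g σ)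
  Σˢ-?·-≡-* A {f} {g} k f≡kg = trans (Σˢ-cong pointwise) (sym (*-distribˡ-Σˢ k (λ σ → A σ ?· g σ)))
    where
    pointwise : ∀ σ → A σ ?· f σ ≡ k * (A σ ?· g σ)
    pointwise σ with A σ in Aσ
    ... | true  = f≡kg σ Aσ
    ... | false = sym (*-zeroʳ k)

  term≤Σˢ : ∀ {n} (f : Subset n → ℕ) p → f p ≤ Σˢ f
  term≤Σˢ f []            = ≤-refl
  term≤Σˢ f (inside ∷ p)  = ≤-trans (term≤Σˢ (f ∘ (inside ∷_)) p) (m≤m+n _ _)
  term≤Σˢ f (outside ∷ p) = ≤-trans (term≤Σˢ (f ∘ (outside ∷_)) p) (m≤n+m _ _)

  Σˢ-∑-comm : ∀ {n m} (h : Subset n → Fin m → ℕ) →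
    Σˢ (λ p → ∑[ v < m ] h p v) ≡ ∑[ v < m ] Σˢ (λ p → h p v)
  Σˢ-∑-comm {zero}  h = refl
  Σˢ-∑-comm {suc n} h = trans
    (cong₂ _+_ (Σˢ-∑-comm (h ∘ (inside ∷_))) (Σˢ-∑-comm (h ∘ (outside ∷_))))
    (sym (∑-distrib-+ (λ v → Σˢ (λ p → h (inside ∷ p) v)) (λ v → Σˢ (λ p → h (outside ∷ p) v))))

  map-allSubsets : ∀ {n} {A : Set} (f : Subset (suc n) → A) →
    map f (allSubsets (suc n)) ≡ map (f ∘ (inside ∷_)) (allSubsets n) ++ map (f ∘ (outside ∷_)) (allSubsets n)
  map-allSubsets {n} f = trans (map-++ f (map (inside ∷_) (allSubsets n)) _)
    (cong₂ _++_ (sym (map-∘ (allSubsets n))) (sym (map-∘ (allSubsets n))))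

  sum-allSubsets : ∀ {n} (f : Subset n → ℕ) → sumℕ (map f (allSubsets n)) ≡ Σˢ f
  sum-allSubsets {zero}  f = +-identityʳ (f [])
  sum-allSubsets {suc n} f = begin
    sumℕ (map f (allSubsets (suc n)))
      ≡⟨ cong sumℕ (map-allSubsets f) ⟩
    sumℕ (map (f ∘ (inside ∷_)) (allSubsets n) ++ map (f ∘ (outside ∷_)) (allSubsets n))
      ≡⟨ sum-++ (map (f ∘ (inside ∷_)) (allSubsets n)) _ ⟩
    sumℕ (map (f ∘ (inside ∷_)) (allSubsets n)) + sumℕ (map (f ∘ (outside ∷_)) (allSubsets n))
      ≡⟨ cong₂ _+_ (sum-allSubsets (f ∘ (inside ∷_))) (sum-allSubsets (f ∘ (outside ∷_))) ⟩
    Σˢ f ∎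
    where open ≡-Reasoning

  length-filter≡sum : ∀ {A : Set} (P : A → Bool) (xs : List A) →
    length (filter (λ x → P x Bool.≟ true) xs) ≡ sumℕ (map (𝟙 ∘ P) xs)
  length-filter≡sum P []       = refl
  length-filter≡sum P (x ∷ xs) with P x
  ... | true  = cong suc (length-filter≡sum P xs)
  ... | false = length-filter≡sum P xs

  count≡Σˢ : ∀ {n} (P : Subset n → Bool) → count P ≡ Σˢ (𝟙 ∘ P)
  count≡Σˢ {n} P = trans (length-filter≡sum P (allSubsets n)) (sum-allSubsets (𝟙 ∘ P))

  ∈-allSubsets : ∀ {n} (p : Subset n) → p ∈ allSubsets n
  ∈-allSubsets []            = here refl
  ∈-allSubsets (inside ∷ p)  = ∈-++⁺ˡ (∈-map⁺ (inside ∷_) (∈-allSubsets p))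
  ∈-allSubsets (outside ∷ p) = ∈-++⁺ʳ _ (∈-map⁺ (outside ∷_) (∈-allSubsets p))

  max-allSubsets-≤ : ∀ {n} (f : Subset n → ℕ) {m} → (∀ p → f p ≤ m) →
    foldr _⊔_ 0 (map f (allSubsets n)) ≤ m
  max-allSubsets-≤ {n} f {m} f≤m =
    foldr-preservesᵇ {P = _≤ m} ⊔-lub z≤n (Allₚ.map⁺ (universal f≤m (allSubsets n)))

  ≤-max-allSubsets : ∀ {n} (f : Subset n → ℕ) p → f p ≤ foldr _⊔_ 0 (map f (allSubsets n))
  ≤-max-allSubsets f p = foldr-preservesᵒ {P = f p ≤_}
    (λ x y → [ (λ le → ≤-trans le (m≤m⊔n x y)) , (λ le → ≤-trans le (m≤n⊔m x y)) ])
    0 (map f _) (inj₂ (Anyₚ.map⁺ (Any.map (λ { refl → ≤-refl }) (∈-allSubsets p))))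

  max-allSubsets≡ : ∀ {n} (f : Subset n → ℕ) {m} q → (∀ p → f p ≤ m) → f q ≡ m →
    foldr _⊔_ 0 (map f (allSubsets n)) ≡ m
  max-allSubsets≡ f q f≤m fq≡m =
    ≤-antisym (max-allSubsets-≤ f f≤m) (subst (_≤ _) fq≡m (≤-max-allSubsets f q))

  ⊥-⊆ᵇ : ∀ {n} (F : Subset n) → (⊥ ⊆ᵇ F) ≡ true
  ⊥-⊆ᵇ []      = refl
  ⊥-⊆ᵇ (_ ∷ F) = ⊥-⊆ᵇ F

  ⊥-disjointᵇ : ∀ {n} (σ : Subset n) → disjointᵇ ⊥ σ ≡ true
  ⊥-disjointᵇ []      = refl
  ⊥-disjointᵇ (_ ∷ σ) = ⊥-disjointᵇ σ

  ⁅⁆-⊆ᵇ : ∀ {n} (v : Fin n) F → (⁅ v ⁆ ⊆ᵇ F) ≡ lookup F v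
  ⁅⁆-⊆ᵇ zero    (inside ∷ F)  = ⊥-⊆ᵇ F
  ⁅⁆-⊆ᵇ zero    (outside ∷ F) = refl
  ⁅⁆-⊆ᵇ (suc v) (inside ∷ F)  = ⁅⁆-⊆ᵇ v F
  ⁅⁆-⊆ᵇ (suc v) (outside ∷ F) = ⁅⁆-⊆ᵇ v F

  ⁅⁆∪-⊆ᵇ : ∀ {n} (v : Fin n) τ F → ((⁅ v ⁆ ∪ τ) ⊆ᵇ F) ≡ lookup F v ∧ (τ ⊆ᵇ F)
  ⁅⁆∪-⊆ᵇ zero    (x ∷ τ)       (inside ∷ F)  rewrite ∪-identityˡ τ with x
  ... | inside  = refl
  ... | outside = refl
  ⁅⁆∪-⊆ᵇ zero    (x ∷ τ)       (outside ∷ F) = refl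
  ⁅⁆∪-⊆ᵇ (suc v) (inside ∷ τ)  (inside ∷ F)  = ⁅⁆∪-⊆ᵇ v τ F
  ⁅⁆∪-⊆ᵇ (suc v) (inside ∷ τ)  (outside ∷ F) = sym (∧-zeroʳ (lookup F v))
  ⁅⁆∪-⊆ᵇ (suc v) (outside ∷ τ) (_ ∷ F)       = ⁅⁆∪-⊆ᵇ v τ F

  ⁅⁆-disjointᵇ : ∀ {n} (v : Fin n) σ → disjointᵇ ⁅ v ⁆ σ ≡ not (lookup σ v)
  ⁅⁆-disjointᵇ zero    (inside ∷ σ)  = refl
  ⁅⁆-disjointᵇ zero    (outside ∷ σ) = ⊥-disjointᵇ σ
  ⁅⁆-disjointᵇ (suc v) (_ ∷ σ)       = ⁅⁆-disjointᵇ v σ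

  lookup-─ : ∀ {n} (G σ : Subset n) v → lookup (G ─ σ) v ≡ lookup G v ∧ not (lookup σ v)
  lookup-─ (x ∷ G) (inside ∷ σ)  zero    = sym (∧-zeroʳ x)
  lookup-─ (x ∷ G) (outside ∷ σ) zero    = sym (∧-identityʳ x)
  lookup-─ (_ ∷ G) (_ ∷ σ)       (suc v) = lookup-─ G σ v

  ─-disjointᵇ : ∀ {n} (G σ : Subset n) → disjointᵇ (G ─ σ) σ ≡ true
  ─-disjointᵇ []            []            = refl
  ─-disjointᵇ (_ ∷ G)       (inside ∷ σ)  = ─-disjointᵇ G σ
  ─-disjointᵇ (inside ∷ G)  (outside ∷ σ) = ─-disjointᵇ G σ
  ─-disjointᵇ (outside ∷ G) (outside ∷ σ) = ─-disjointᵇ G σ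

  ─∪-cancel : ∀ {n} (σ G : Subset n) → (σ ⊆ᵇ G) ≡ true → (G ─ σ) ∪ σ ≡ G
  ─∪-cancel []            []            _   = refl
  ─∪-cancel (inside ∷ σ)  (inside ∷ G)  σ⊆G = cong (inside ∷_) (─∪-cancel σ G σ⊆G)
  ─∪-cancel (outside ∷ σ) (inside ∷ G)  σ⊆G = cong (inside ∷_) (─∪-cancel σ G σ⊆G)
  ─∪-cancel (outside ∷ σ) (outside ∷ G) σ⊆G = cong (outside ∷_) (─∪-cancel σ G σ⊆G)

  ∣─∣+∣∣ : ∀ {n} (σ G : Subset n) → (σ ⊆ᵇ G) ≡ true → ∣ G ─ σ ∣ + ∣ σ ∣ ≡ ∣ G ∣
  ∣─∣+∣∣ []            []            _   = refl
  ∣─∣+∣∣ (inside ∷ σ)  (inside ∷ G)  σ⊆G = trans (+-suc _ _) (cong suc (∣─∣+∣∣ σ G σ⊆G))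
  ∣─∣+∣∣ (outside ∷ σ) (inside ∷ G)  σ⊆G = cong suc (∣─∣+∣∣ σ G σ⊆G)
  ∣─∣+∣∣ (outside ∷ σ) (outside ∷ G) σ⊆G = ∣─∣+∣∣ σ G σ⊆G

  ∣─∣≡∣∣∸∣∣ : ∀ {n} (σ G : Subset n) → (σ ⊆ᵇ G) ≡ true → ∣ G ─ σ ∣ ≡ ∣ G ∣ ∸ ∣ σ ∣
  ∣─∣≡∣∣∸∣∣ σ G σ⊆G = trans (sym (m+n∸n≡m ∣ G ─ σ ∣ ∣ σ ∣)) (cong (_∸ ∣ σ ∣) (∣─∣+∣∣ σ G σ⊆G))

  ∣∪∣-disjoint : ∀ {n} (F σ : Subset n) → disjointᵇ F σ ≡ true → ∣ F ∪ σ ∣ ≡ ∣ F ∣ + ∣ σ ∣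
  ∣∪∣-disjoint []            []            _    = refl
  ∣∪∣-disjoint (inside ∷ F)  (outside ∷ σ) F#σ = cong suc (∣∪∣-disjoint F σ F#σ)
  ∣∪∣-disjoint (outside ∷ F) (inside ∷ σ)  F#σ = trans (cong suc (∣∪∣-disjoint F σ F#σ)) (sym (+-suc _ _))
  ∣∪∣-disjoint (outside ∷ F) (outside ∷ σ) F#σ = ∣∪∣-disjoint F σ F#σ

  ∣⁅⁆∪∣ : ∀ {n} (v : Fin n) τ → lookup τ v ≡ false → ∣ ⁅ v ⁆ ∪ τ ∣ ≡ suc ∣ τ ∣
  ∣⁅⁆∪∣ zero    (outside ∷ τ) _   = cong (suc ∘ ∣_∣) (∪-identityˡ τ)
  ∣⁅⁆∪∣ (suc v) (inside ∷ τ)  v∉τ = cong suc (∣⁅⁆∪∣ v τ v∉τ)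
  ∣⁅⁆∪∣ (suc v) (outside ∷ τ) v∉τ = ∣⁅⁆∪∣ v τ v∉τ

  Σˢ-remove≡Σˢ-insert : ∀ {n} (v : Fin n) (h : Subset n → Subset n → ℕ) →
    Σˢ (λ σ → lookup σ v ?· h σ (σ - v)) ≡ Σˢ (λ τ → not (lookup τ v) ?· h (⁅ v ⁆ ∪ τ) τ)
  Σˢ-remove≡Σˢ-insert {suc n} zero h = begin
    Σˢ (λ p → h (inside ∷ p) (outside ∷ (p ─ ⊥))) + Σˢ {n} (λ _ → 0)
      ≡⟨ cong₂ _+_ (Σˢ-cong (λ p → cong (h (inside ∷ p) ∘ (outside ∷_)) (p─⊥≡p p))) (Σˢ-zero {n} (λ _ → refl)) ⟩
    Σˢ (λ p → h (inside ∷ p) (outside ∷ p)) + 0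
      ≡⟨ +-comm _ 0 ⟩
    0 + Σˢ (λ p → h (inside ∷ p) (outside ∷ p))
      ≡⟨ cong₂ _+_ (sym (Σˢ-zero {n} (λ _ → refl))) (Σˢ-cong (λ p → cong (λ q → h (inside ∷ q) (outside ∷ p)) (sym (∪-identityˡ p)))) ⟩
    Σˢ {n} (λ _ → 0) + Σˢ (λ p → h (inside ∷ (⊥ ∪ p)) (outside ∷ p)) ∎
    where open ≡-Reasoning
  Σˢ-remove≡Σˢ-insert (suc v) h = cong₂ _+_
    (Σˢ-remove≡Σˢ-insert v (λ σ τ → h (inside ∷ σ) (inside ∷ τ)))
    (Σˢ-remove≡Σˢ-insert v (λ σ τ → h (outside ∷ σ) (outside ∷ τ)))

  Σˢ∑-remove≡Σˢ∑-insert : ∀ {n} (h : Subset n → Subset n → ℕ) →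
    Σˢ (λ σ → ∑[ v < n ] (lookup σ v ?· h σ (σ - v))) ≡
    Σˢ (λ τ → ∑[ v < n ] (not (lookup τ v) ?· h (⁅ v ⁆ ∪ τ) τ))
  Σˢ∑-remove≡Σˢ∑-insert h = trans (Σˢ-∑-comm (λ σ v → lookup σ v ?· h σ (σ - v)))
    (trans (sum-cong-≗ (λ v → Σˢ-remove≡Σˢ-insert v h))
           (sym (Σˢ-∑-comm (λ τ v → not (lookup τ v) ?· h (⁅ v ⁆ ∪ τ) τ))))

  Σˢ-single : ∀ {n} (σ : Subset n) (g : Subset n → ℕ) → Σˢ (λ τ → single σ τ ?· g τ) ≡ g σ
  Σˢ-single []            g = refl
  Σˢ-single {suc n} (inside ∷ σ)  g = trans
    (cong₂ _+_ refl (Σˢ-zero (λ τ → cong (_?· g (outside ∷ τ)) (∧-zeroʳ (τ ⊆ᵇ σ)))))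
    (trans (+-identityʳ _) (Σˢ-single σ (g ∘ (inside ∷_))))
  Σˢ-single {suc n} (outside ∷ σ) g = trans
    (cong₂ _+_ (Σˢ-zero {n} (λ _ → refl)) refl) (Σˢ-single σ (g ∘ (outside ∷_)))

  Σˢ-size-0 : ∀ {n} (h : Subset n → ℕ) → Σˢ (λ ρ → (∣ ρ ∣ ≡ᵇ 0) ?· h ρ) ≡ h ⊥
  Σˢ-size-0 {zero}  h = refl
  Σˢ-size-0 {suc n} h = trans (cong₂ _+_ (Σˢ-zero {n} (λ _ → refl)) refl) (Σˢ-size-0 (h ∘ (outside ∷_)))

  Σˢ-size-1 : ∀ {n} (h : Subset n → ℕ) → Σˢ (λ ρ → (∣ ρ ∣ ≡ᵇ 1) ?· h ρ) ≡ ∑[ v < n ] h ⁅ v ⁆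
  Σˢ-size-1 {zero}  h = refl
  Σˢ-size-1 {suc n} h = cong₂ _+_ (Σˢ-size-0 (h ∘ (inside ∷_))) (Σˢ-size-1 (h ∘ (outside ∷_)))

  Σˢ-disjoint≡Σˢ-⊇ : ∀ {n} (σ : Subset n) (h : Subset n → Subset n → ℕ) →
    Σˢ (λ F → disjointᵇ F σ ?· h F (F ∪ σ)) ≡ Σˢ (λ G → (σ ⊆ᵇ G) ?· h (G ─ σ) G)
  Σˢ-disjoint≡Σˢ-⊇ []            h = refl
  Σˢ-disjoint≡Σˢ-⊇ {suc n} (inside ∷ σ)  h = begin
    Σˢ {n} (λ _ → 0) + Σˢ (λ F → disjointᵇ F σ ?· h (outside ∷ F) (inside ∷ (F ∪ σ)))
      ≡⟨ cong₂ _+_ (Σˢ-zero {n} (λ _ → refl)) (Σˢ-disjoint≡Σˢ-⊇ σ (λ F G → h (outside ∷ F) (inside ∷ G))) ⟩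
    0 + Σˢ (λ G → (σ ⊆ᵇ G) ?· h (outside ∷ (G ─ σ)) (inside ∷ G))
      ≡⟨ +-comm 0 _ ⟩
    Σˢ (λ G → (σ ⊆ᵇ G) ?· h (outside ∷ (G ─ σ)) (inside ∷ G)) + 0
      ≡⟨ cong₂ _+_ refl (sym (Σˢ-zero {n} (λ _ → refl))) ⟩
    Σˢ (λ G → (σ ⊆ᵇ G) ?· h (outside ∷ (G ─ σ)) (inside ∷ G)) + Σˢ {n} (λ _ → 0) ∎
    where open ≡-Reasoning
  Σˢ-disjoint≡Σˢ-⊇ (outside ∷ σ) h = cong₂ _+_
    (Σˢ-disjoint≡Σˢ-⊇ σ (λ F G → h (inside ∷ F) (inside ∷ G)))
    (Σˢ-disjoint≡Σˢ-⊇ σ (λ F G → h (outside ∷ F) (outside ∷ G)))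

  length-filter-vertices : ∀ {n} (σ : Subset n) (P : Fin n → Bool) →
    length (filter (λ v → P v Bool.≟ true) (vertices σ)) ≡ ∑[ v < n ] (lookup σ v ?· 𝟙 (P v))
  length-filter-vertices σ P = trans (length-filter≡sum P (vertices σ)) (sum-vertices σ (𝟙 ∘ P))
    where
    sum-vertices : ∀ {n} (σ : Subset n) (f : Fin n → ℕ) →
      sumℕ (map f (vertices σ)) ≡ ∑[ v < n ] (lookup σ v ?· f v)
    sum-vertices []            f = refl
    sum-vertices (inside ∷ σ)  f = cong (f zero +_) (trans (cong sumℕ (sym (map-∘ (vertices σ)))) (sum-vertices σ (f ∘ suc)))
    sum-vertices (outside ∷ σ) f = trans (cong sumℕ (sym (map-∘ (vertices σ)))) (sum-vertices σ (f ∘ suc))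

  module Degrees {n} (X : Family n) (D : ℕ) where

    top : Family n
    top = level X D

    degree : Subset n → ℕ
    degree σ = Σˢ (λ G → 𝟙 (top G ∧ (σ ⊆ᵇ G)))

    mass : Family n → ℕ
    mass A = Σˢ (λ σ → A σ ?· degree σ)

    ofSize : ℕ → Family n
    ofSize s σ = ∣ σ ∣ ≡ᵇ s

    sizeMass : ℕ → ℕ
    sizeMass s = mass (ofSize s)

    HasSize : Family n → ℕ → Set
    HasSize A s = ∀ σ → A σ ≡ true → ∣ σ ∣ ≡ s

    ofSize-HasSize : ∀ s → HasSize (ofSize s) s
    ofSize-HasSize s σ = ≡ᵇ-true⇒≡

    upperMass : Family n → Subset n → ℕ
    upperMass A τ = ∑[ v < n ] (not (lookup τ v) ?· A (⁅ v ⁆ ∪ τ) ?· degree (⁅ v ⁆ ∪ τ))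

    facetsIn : Family n → Subset n → ℕ
    facetsIn B σ = ∑[ v < n ] (lookup σ v ?· 𝟙 (B (σ - v)))

    facetsOut : Family n → Subset n → ℕ
    facetsOut B σ = ∑[ v < n ] (lookup σ v ?· 𝟙 (not (B (σ - v))))

    exitMass : Family n → Family n → ℕ
    exitMass A B = Σˢ (λ σ → A σ ?· (degree σ * facetsOut B σ))

    -- A top face through σ contains exactly D ∸ ∣ σ ∣ of the faces ⁅ v ⁆ ∪ σ with v ∉ σ.
    ∑-degree-extensions : ∀ σ →
      ∑[ v < n ] (not (lookup σ v) ?· degree (⁅ v ⁆ ∪ σ)) ≡ (D ∸ ∣ σ ∣) * degree σ
    ∑-degree-extensions σ = begin
      ∑[ v < n ] (not (lookup σ v) ?· degree (⁅ v ⁆ ∪ σ))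
        ≡⟨ sum-cong-≗ (λ v → trans (?·-distrib-Σˢ (not (lookup σ v)) (λ G → 𝟙 (top G ∧ ((⁅ v ⁆ ∪ σ) ⊆ᵇ G))))
                                   (Σˢ-cong (extension v))) ⟩
      ∑[ v < n ] Σˢ (λ G → (top G ∧ (σ ⊆ᵇ G)) ?· 𝟙 (lookup (G ─ σ) v))
        ≡⟨ sym (Σˢ-∑-comm (λ G v → (top G ∧ (σ ⊆ᵇ G)) ?· 𝟙 (lookup (G ─ σ) v))) ⟩
      Σˢ (λ G → ∑[ v < n ] ((top G ∧ (σ ⊆ᵇ G)) ?· 𝟙 (lookup (G ─ σ) v)))
        ≡⟨ Σˢ-cong (λ G → sym (?·-distrib-∑ (top G ∧ (σ ⊆ᵇ G)) (λ v → 𝟙 (lookup (G ─ σ) v)))) ⟩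
      Σˢ (λ G → (top G ∧ (σ ⊆ᵇ G)) ?· ∑[ v < n ] 𝟙 (lookup (G ─ σ) v))
        ≡⟨ Σˢ-?·-≡-* (λ G → top G ∧ (σ ⊆ᵇ G)) (D ∸ ∣ σ ∣) vertices-outside-σ ⟩
      (D ∸ ∣ σ ∣) * degree σ ∎
      where
      open ≡-Reasoning
      indicator : ∀ s t g i → not s ?· 𝟙 (t ∧ (g ∧ i)) ≡ (t ∧ i) ?· 𝟙 (g ∧ not s)
      indicator true  t     g     i = sym (trans (cong (λ b → (t ∧ i) ?· 𝟙 b) (∧-zeroʳ g)) (?·-zeroʳ (t ∧ i)))
      indicator false true  true  i = refl
      indicator false true  false i = sym (?·-zeroʳ i)
      indicator false false g     i = refl
      extension : ∀ v G → not (lookup σ v) ?· 𝟙 (top G ∧ ((⁅ v ⁆ ∪ σ) ⊆ᵇ G))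
                          ≡ (top G ∧ (σ ⊆ᵇ G)) ?· 𝟙 (lookup (G ─ σ) v)
      extension v G rewrite ⁅⁆∪-⊆ᵇ v σ G | lookup-─ G σ v = indicator (lookup σ v) (top G) (lookup G v) (σ ⊆ᵇ G)
      vertices-outside-σ : ∀ G → (top G ∧ (σ ⊆ᵇ G)) ≡ true → ∑[ v < n ] 𝟙 (lookup (G ─ σ) v) ≡ (D ∸ ∣ σ ∣) * 1
      vertices-outside-σ G e = begin
        ∑[ v < n ] 𝟙 (lookup (G ─ σ) v) ≡⟨ ∑-𝟙-lookup (G ─ σ) ⟩
        ∣ G ─ σ ∣                          ≡⟨ ∣─∣≡∣∣∸∣∣ σ G (∧-conicalʳ (top G) _ e) ⟩
        ∣ G ∣ ∸ ∣ σ ∣                      ≡⟨ cong (_∸ ∣ σ ∣) (≡ᵇ-true⇒≡ (∧-conicalʳ (X G) _ (∧-conicalˡ (top G) _ e))) ⟩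
        D ∸ ∣ σ ∣                          ≡⟨ sym (*-identityʳ (D ∸ ∣ σ ∣)) ⟩
        (D ∸ ∣ σ ∣) * 1                    ∎

    upperMass-≤ : ∀ A τ → upperMass A τ ≤ (D ∸ ∣ τ ∣) * degree τ
    upperMass-≤ A τ = ≤-trans
      (∑-mono-≤ (λ v → ?·-monoʳ-≤ (not (lookup τ v)) (?·-≤ (A (⁅ v ⁆ ∪ τ)) (degree (⁅ v ⁆ ∪ τ)))))
      (≤-reflexive (∑-degree-extensions τ))

    facetsOut+facetsIn : ∀ B σ → facetsOut B σ + facetsIn B σ ≡ ∣ σ ∣
    facetsOut+facetsIn B σ = begin
      facetsOut B σ + facetsIn B σ
        ≡⟨ sym (∑-distrib-+ (λ v → lookup σ v ?· 𝟙 (not (B (σ - v)))) (λ v → lookup σ v ?· 𝟙 (B (σ - v)))) ⟩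
      ∑[ v < n ] (lookup σ v ?· 𝟙 (not (B (σ - v))) + lookup σ v ?· 𝟙 (B (σ - v)))
        ≡⟨ sum-cong-≗ (λ v → split (lookup σ v) (B (σ - v))) ⟩
      ∑[ v < n ] (lookup σ v ?· 1)
        ≡⟨ ∑-𝟙-lookup σ ⟩
      ∣ σ ∣ ∎
      where
      open ≡-Reasoning
      split : ∀ a b → a ?· 𝟙 (not b) + a ?· 𝟙 b ≡ a ?· 1
      split true  true  = refl
      split true  false = refl
      split false b     = refl

    Σˢ-facetsIn≡Σˢ-upperMass : ∀ A B →
      Σˢ (λ σ → A σ ?· (degree σ * facetsIn B σ)) ≡ Σˢ (λ τ → B τ ?· upperMass A τ)
    Σˢ-facetsIn≡Σˢ-upperMass A B = begin
      Σˢ (λ σ → A σ ?· (degree σ * facetsIn B σ))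
        ≡⟨ Σˢ-cong facets ⟩
      Σˢ (λ σ → ∑[ v < n ] (lookup σ v ?· h σ (σ - v)))
        ≡⟨ Σˢ∑-remove≡Σˢ∑-insert h ⟩
      Σˢ (λ τ → ∑[ v < n ] (not (lookup τ v) ?· h (⁅ v ⁆ ∪ τ) τ))
        ≡⟨ Σˢ-cong cofacets ⟩
      Σˢ (λ τ → B τ ?· upperMass A τ) ∎
      where
      open ≡-Reasoning
      h : Subset n → Subset n → ℕ
      h σ τ = A σ ?· B τ ?· degree σ
      *-?·-𝟙 : ∀ k a b → k * (a ?· 𝟙 b) ≡ a ?· b ?· k
      *-?·-𝟙 k true  true  = *-identityʳ k
      *-?·-𝟙 k true  false = *-zeroʳ k
      *-?·-𝟙 k false b     = *-zeroʳ k
      facets : ∀ σ → A σ ?· (degree σ * facetsIn B σ) ≡ ∑[ v < n ] (lookup σ v ?· h σ (σ - v))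
      facets σ with A σ
      ... | true  = trans (*-distribˡ-sum (degree σ) (λ v → lookup σ v ?· 𝟙 (B (σ - v))))
                          (sum-cong-≗ (λ v → *-?·-𝟙 (degree σ) (lookup σ v) (B (σ - v))))
      ... | false = sym (∑-zero (λ v → ?·-zeroʳ (lookup σ v)))
      cofacets : ∀ τ → ∑[ v < n ] (not (lookup τ v) ?· h (⁅ v ⁆ ∪ τ) τ) ≡ B τ ?· upperMass A τ
      cofacets τ with B τ
      ... | true  = refl
      ... | false = ∑-zero (λ v → trans (cong (not (lookup τ v) ?·_) (?·-zeroʳ (A (⁅ v ⁆ ∪ τ)))) (?·-zeroʳ _))

    Σˢ-upperMass : ∀ A r → HasSize A (suc r) → Σˢ (upperMass A) ≡ suc r * mass A
    Σˢ-upperMass A r A⊆r+1 = begin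
      Σˢ (upperMass A)                                          ≡⟨ sym (Σˢ-facetsIn≡Σˢ-upperMass A (λ _ → true)) ⟩
      Σˢ (λ σ → A σ ?· (degree σ * facetsIn (λ _ → true) σ))   ≡⟨ Σˢ-?·-≡-* A (suc r) all-facets ⟩
      suc r * mass A                                            ∎
      where
      open ≡-Reasoning
      all-facets : ∀ σ → A σ ≡ true → degree σ * facetsIn (λ _ → true) σ ≡ suc r * degree σ
      all-facets σ Aσ = trans (cong (degree σ *_) (trans (∑-𝟙-lookup σ) (A⊆r+1 σ Aσ))) (*-comm (degree σ) (suc r))

    exitMass-bound : ∀ A B r → HasSize A (suc r) → HasSize B r →
      suc r * mass A ≤ exitMass A B + (D ∸ r) * mass B
    exitMass-bound A B r A⊆r+1 B⊆r = begin
      suc r * mass A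
        ≡⟨ sym (Σˢ-?·-≡-* A (suc r) facets-split) ⟩
      Σˢ (λ σ → A σ ?· (degree σ * facetsOut B σ + degree σ * facetsIn B σ))
        ≡⟨ Σˢ-cong (λ σ → ?·-distrib-+ (A σ)) ⟩
      Σˢ (λ σ → A σ ?· (degree σ * facetsOut B σ) + A σ ?· (degree σ * facetsIn B σ))
        ≡⟨ Σˢ-distrib-+ (λ σ → A σ ?· (degree σ * facetsOut B σ)) _ ⟩
      exitMass A B + Σˢ (λ σ → A σ ?· (degree σ * facetsIn B σ))
        ≡⟨ cong (exitMass A B +_) (Σˢ-facetsIn≡Σˢ-upperMass A B) ⟩
      exitMass A B + Σˢ (λ τ → B τ ?· upperMass A τ)
        ≤⟨ +-monoʳ-≤ (exitMass A B) (Σˢ-mono-≤ (λ τ → ?·-monoʳ-≤ (B τ) (upperMass-≤ A τ))) ⟩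
      exitMass A B + Σˢ (λ τ → B τ ?· ((D ∸ ∣ τ ∣) * degree τ))
        ≡⟨ cong (exitMass A B +_) (Σˢ-?·-≡-* B (D ∸ r) (λ τ Bτ → cong (λ s → (D ∸ s) * degree τ) (B⊆r τ Bτ))) ⟩
      exitMass A B + (D ∸ r) * mass B ∎
      where
      open ≤-Reasoning
      facets-split : ∀ σ → A σ ≡ true → degree σ * facetsOut B σ + degree σ * facetsIn B σ ≡ suc r * degree σ
      facets-split σ Aσ = begin-equality
        degree σ * facetsOut B σ + degree σ * facetsIn B σ ≡⟨ sym (*-distribˡ-+ (degree σ) _ _) ⟩
        degree σ * (facetsOut B σ + facetsIn B σ)          ≡⟨ cong (degree σ *_) (facetsOut+facetsIn B σ) ⟩
        degree σ * ∣ σ ∣                                   ≡⟨ cong (degree σ *_) (A⊆r+1 σ Aσ) ⟩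
        degree σ * suc r                                   ≡⟨ *-comm (degree σ) (suc r) ⟩
        suc r * degree σ                                   ∎

    sizeMass-step : ∀ r → suc r * sizeMass (suc r) ≡ (D ∸ r) * sizeMass r
    sizeMass-step r = begin
      suc r * sizeMass (suc r)
        ≡⟨ sym (Σˢ-upperMass (ofSize (suc r)) r (ofSize-HasSize (suc r))) ⟩
      Σˢ (upperMass (ofSize (suc r)))
        ≡⟨ Σˢ-cong upperMass-ofSize ⟩
      Σˢ (λ τ → ofSize r τ ?· ((D ∸ ∣ τ ∣) * degree τ))
        ≡⟨ Σˢ-?·-≡-* (ofSize r) (D ∸ r) (λ τ e → cong (λ s → (D ∸ s) * degree τ) (ofSize-HasSize r τ e)) ⟩
      (D ∸ r) * sizeMass r ∎
      where
      open ≡-Reasoning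
      extension-ofSize : ∀ τ v → not (lookup τ v) ?· ofSize (suc r) (⁅ v ⁆ ∪ τ) ?· degree (⁅ v ⁆ ∪ τ)
                                 ≡ ofSize r τ ?· not (lookup τ v) ?· degree (⁅ v ⁆ ∪ τ)
      extension-ofSize τ v with lookup τ v in τv
      ... | true  = sym (?·-zeroʳ (ofSize r τ))
      ... | false rewrite ∣⁅⁆∪∣ v τ τv = refl
      upperMass-ofSize : ∀ τ → upperMass (ofSize (suc r)) τ ≡ ofSize r τ ?· ((D ∸ ∣ τ ∣) * degree τ)
      upperMass-ofSize τ = begin
        upperMass (ofSize (suc r)) τ
          ≡⟨ sum-cong-≗ (extension-ofSize τ) ⟩
        ∑[ v < n ] (ofSize r τ ?· not (lookup τ v) ?· degree (⁅ v ⁆ ∪ τ))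
          ≡⟨ sym (?·-distrib-∑ (ofSize r τ) (λ v → not (lookup τ v) ?· degree (⁅ v ⁆ ∪ τ))) ⟩
        ofSize r τ ?· ∑[ v < n ] (not (lookup τ v) ?· degree (⁅ v ⁆ ∪ τ))
          ≡⟨ cong (ofSize r τ ?·_) (∑-degree-extensions τ) ⟩
        ofSize r τ ?· ((D ∸ ∣ τ ∣) * degree τ) ∎

    weight : ℕ → ℕ
    weight s = s ! * (D ∸ s) !

    stepWeight : ℕ → ℕ
    stepWeight r = r ! * (D ∸ suc r) !

    weight-suc : ∀ r → weight (suc r) ≡ suc r * stepWeight r
    weight-suc r = *-assoc (suc r) (r !) ((D ∸ suc r) !)

    weight-≡-∸ : ∀ r → suc r ≤ D → weight r ≡ (D ∸ r) * stepWeight r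
    weight-≡-∸ r r<D = begin
      r ! * (D ∸ r) !                         ≡⟨ cong (λ k → r ! * k !) D∸r≡1+[D∸1+r] ⟩
      r ! * (suc (D ∸ suc r) * (D ∸ suc r) !) ≡⟨ x*[y*z]≡y*[x*z] (r !) (suc (D ∸ suc r)) _ ⟩
      suc (D ∸ suc r) * stepWeight r          ≡⟨ cong (_* stepWeight r) (sym D∸r≡1+[D∸1+r]) ⟩
      (D ∸ r) * stepWeight r                  ∎
      where
      open ≡-Reasoning
      D∸r≡1+[D∸1+r] : D ∸ r ≡ suc (D ∸ suc r)
      D∸r≡1+[D∸1+r] = +-∸-assoc 1 r<D

    sizeMass-weight : ∀ s → s ≤ D → sizeMass s * weight s ≡ sizeMass 0 * weight 0
    sizeMass-weight zero    _   = refl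
    sizeMass-weight (suc r) r<D = begin
      sizeMass (suc r) * weight (suc r)         ≡⟨ cong (sizeMass (suc r) *_) (weight-suc r) ⟩
      sizeMass (suc r) * (suc r * stepWeight r) ≡⟨ x*[y*z]≡[y*x]*z (sizeMass (suc r)) (suc r) (stepWeight r) ⟩
      (suc r * sizeMass (suc r)) * stepWeight r ≡⟨ cong (_* stepWeight r) (sizeMass-step r) ⟩
      ((D ∸ r) * sizeMass r) * stepWeight r     ≡⟨ [x*y]*z≡y*[x*z] (D ∸ r) (sizeMass r) (stepWeight r) ⟩
      sizeMass r * ((D ∸ r) * stepWeight r)     ≡⟨ cong (sizeMass r *_) (sym (weight-≡-∸ r r<D)) ⟩
      sizeMass r * weight r                     ≡⟨ sizeMass-weight r (<⇒≤ r<D) ⟩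
      sizeMass 0 * weight 0                     ∎
      where open ≡-Reasoning

module Fractions where

  open import Data.Nat as ℕ using (ℕ; zero; suc)
  import Data.Nat.Properties as ℕ
  open import Data.Integer as ℤ using (+_)
  import Data.Integer.Properties as ℤ
  open import Data.Rational using (ℚ; 0ℚ; _+_; _*_; _≤_; _<_; toℚᵘ; Positive; NonNegative; positive; nonNegative)
  open import Data.Rational.Properties
  import Data.Rational.Unnormalised as ℚᵘ
  import Data.Rational.Unnormalised.Properties as ℚᵘ
  open import Algebra.Bundles using (CommutativeMonoid)
  open import Algebra.Properties.CommutativeSemigroup (CommutativeMonoid.commutativeSemigroup *-1-commutativeMonoid)
    using (interchange)
  open import Relation.Binary.PropositionalEquality

  ⟦_⟧ : ℕ → ℚ
  ⟦ a ⟧ = frac a 1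

  toℚᵘ-frac : ∀ a b → toℚᵘ (frac a (suc b)) ℚᵘ.≃ ℚᵘ.mkℚᵘ (+ a) b
  toℚᵘ-frac a b = toℚᵘ-fromℚᵘ (ℚᵘ.mkℚᵘ (+ a) b)

  via-toℚᵘ : ∀ {p q} {p′ q′ : ℚᵘ.ℚᵘ} → toℚᵘ p ℚᵘ.≃ p′ → toℚᵘ q ℚᵘ.≃ q′ → p′ ℚᵘ.≃ q′ → p ≡ q
  via-toℚᵘ p≃ q≃ p′≃q′ = toℚᵘ-injective (ℚᵘ.≃-trans p≃ (ℚᵘ.≃-trans p′≃q′ (ℚᵘ.≃-sym q≃)))

  ⟦⟧-+ : ∀ a b → ⟦ a ℕ.+ b ⟧ ≡ ⟦ a ⟧ + ⟦ b ⟧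
  ⟦⟧-+ a b = via-toℚᵘ (toℚᵘ-frac (a ℕ.+ b) 0)
    (ℚᵘ.≃-trans (toℚᵘ-homo-+ ⟦ a ⟧ ⟦ b ⟧) (ℚᵘ.+-cong (toℚᵘ-frac a 0) (toℚᵘ-frac b 0)))
    (ℚᵘ.*≡* (cong (ℤ._* + 1) (begin
      + (a ℕ.+ b)                   ≡⟨ ℤ.pos-+ a b ⟩
      + a ℤ.+ + b                   ≡⟨ sym (cong₂ ℤ._+_ (ℤ.*-identityʳ (+ a)) (ℤ.*-identityʳ (+ b))) ⟩
      + a ℤ.* + 1 ℤ.+ + b ℤ.* + 1   ∎)))
    where open ≡-Reasoning

  ⟦⟧-* : ∀ a b → ⟦ a ℕ.* b ⟧ ≡ ⟦ a ⟧ * ⟦ b ⟧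
  ⟦⟧-* a b = via-toℚᵘ (toℚᵘ-frac (a ℕ.* b) 0)
    (ℚᵘ.≃-trans (toℚᵘ-homo-* ⟦ a ⟧ ⟦ b ⟧) (ℚᵘ.*-cong (toℚᵘ-frac a 0) (toℚᵘ-frac b 0)))
    (ℚᵘ.*≡* (cong (ℤ._* + 1) (ℤ.pos-* a b)))

  ⟦⟧-mono-≤ : ∀ {a b} → a ℕ.≤ b → ⟦ a ⟧ ≤ ⟦ b ⟧
  ⟦⟧-mono-≤ {a} {b} a≤b = toℚᵘ-cancel-≤
    (ℚᵘ.≤-respˡ-≃ (ℚᵘ.≃-sym (toℚᵘ-frac a 0)) (ℚᵘ.≤-respʳ-≃ (ℚᵘ.≃-sym (toℚᵘ-frac b 0))
      (ℚᵘ.*≤* (ℤ.*-monoʳ-≤-nonNeg (+ 1) (ℤ.+≤+ a≤b)))))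

  ⟦⟧-mono-< : ∀ {a b} → a ℕ.< b → ⟦ a ⟧ < ⟦ b ⟧
  ⟦⟧-mono-< {a} {b} a<b = toℚᵘ-cancel-<
    (ℚᵘ.<-respˡ-≃ (ℚᵘ.≃-sym (toℚᵘ-frac a 0)) (ℚᵘ.<-respʳ-≃ (ℚᵘ.≃-sym (toℚᵘ-frac b 0))
      (ℚᵘ.*<* (ℤ.*-monoʳ-<-pos (+ 1) (ℤ.+<+ a<b)))))

  ⟦suc⟧-positive : ∀ k → Positive ⟦ suc k ⟧
  ⟦suc⟧-positive k = positive (⟦⟧-mono-< {0} {suc k} (ℕ.s≤s ℕ.z≤n))

  ⟦⟧-nonNegative : ∀ k → NonNegative ⟦ k ⟧
  ⟦⟧-nonNegative k = nonNegative (⟦⟧-mono-≤ {0} {k} ℕ.z≤n)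

  frac-*-cancel : ∀ a b → frac a (suc b) * ⟦ suc b ⟧ ≡ ⟦ a ⟧
  frac-*-cancel a b = via-toℚᵘ
    (ℚᵘ.≃-trans (toℚᵘ-homo-* (frac a (suc b)) ⟦ suc b ⟧) (ℚᵘ.*-cong (toℚᵘ-frac a b) (toℚᵘ-frac (suc b) 0)))
    (toℚᵘ-frac a 0)
    (ℚᵘ.*≡* (begin
      (+ a ℤ.* + suc b) ℤ.* + 1  ≡⟨ ℤ.*-identityʳ _ ⟩
      + a ℤ.* + suc b            ≡⟨ cong (λ k → + a ℤ.* + k) (sym (ℕ.*-identityʳ (suc b))) ⟩
      + a ℤ.* + (suc b ℕ.* 1)    ∎))
    where open ≡-Reasoning

  *-cancelʳ-⟦suc⟧ : ∀ {x y} k → x * ⟦ suc k ⟧ ≡ y * ⟦ suc k ⟧ → x ≡ y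
  *-cancelʳ-⟦suc⟧ k xk≡yk = ≤-antisym
    (*-cancelʳ-≤-pos ⟦ suc k ⟧ {{⟦suc⟧-positive k}} (≤-reflexive xk≡yk))
    (*-cancelʳ-≤-pos ⟦ suc k ⟧ {{⟦suc⟧-positive k}} (≤-reflexive (sym xk≡yk)))

  frac-zero : ∀ K → frac 0 K ≡ 0ℚ
  frac-zero zero    = refl
  frac-zero (suc k) = 0/n≡0 (suc k)

  frac-+ : ∀ a b K → frac a K + frac b K ≡ frac (a ℕ.+ b) K
  frac-+ a b zero    = +-identityʳ 0ℚ
  frac-+ a b (suc k) = *-cancelʳ-⟦suc⟧ k (begin
    (frac a (suc k) + frac b (suc k)) * ⟦ suc k ⟧              ≡⟨ *-distribʳ-+ ⟦ suc k ⟧ (frac a (suc k)) _ ⟩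
    frac a (suc k) * ⟦ suc k ⟧ + frac b (suc k) * ⟦ suc k ⟧    ≡⟨ cong₂ _+_ (frac-*-cancel a k) (frac-*-cancel b k) ⟩
    ⟦ a ⟧ + ⟦ b ⟧                                              ≡⟨ sym (⟦⟧-+ a b) ⟩
    ⟦ a ℕ.+ b ⟧                                                ≡⟨ sym (frac-*-cancel (a ℕ.+ b) k) ⟩
    frac (a ℕ.+ b) (suc k) * ⟦ suc k ⟧                         ∎)
    where open ≡-Reasoning

  frac-* : ∀ a b T s → frac a T * frac b (suc s) ≡ frac (a ℕ.* b) (T ℕ.* suc s)
  frac-* a b zero    s = *-zeroˡ (frac b (suc s))
  frac-* a b (suc t) s = *-cancelʳ-⟦suc⟧ (s ℕ.+ t ℕ.* suc s) (begin
    (fa * fb) * ⟦ suc t ℕ.* suc s ⟧             ≡⟨ cong ((fa * fb) *_) (⟦⟧-* (suc t) (suc s)) ⟩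
    (fa * fb) * (⟦ suc t ⟧ * ⟦ suc s ⟧)         ≡⟨ interchange fa fb ⟦ suc t ⟧ ⟦ suc s ⟧ ⟩
    (fa * ⟦ suc t ⟧) * (fb * ⟦ suc s ⟧)         ≡⟨ cong₂ _*_ (frac-*-cancel a t) (frac-*-cancel b s) ⟩
    ⟦ a ⟧ * ⟦ b ⟧                               ≡⟨ sym (⟦⟧-* a b) ⟩
    ⟦ a ℕ.* b ⟧                                 ≡⟨ sym (frac-*-cancel (a ℕ.* b) (s ℕ.+ t ℕ.* suc s)) ⟩
    frac (a ℕ.* b) (suc t ℕ.* suc s) * ⟦ suc t ℕ.* suc s ⟧ ∎)
    where
    open ≡-Reasoning
    fa = frac a (suc t)
    fb = frac b (suc s)

  frac-scale : ∀ a T k .{{_ : ℕ.NonZero k}} → frac a T ≡ frac (a ℕ.* k) (T ℕ.* k)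
  frac-scale a zero    (suc k) = refl
  frac-scale a (suc b) (suc k) = sym (*-cancelʳ-⟦suc⟧ (k ℕ.+ b ℕ.* suc k) (begin
    frac (a ℕ.* suc k) (suc b ℕ.* suc k) * ⟦ suc b ℕ.* suc k ⟧ ≡⟨ frac-*-cancel (a ℕ.* suc k) (k ℕ.+ b ℕ.* suc k) ⟩
    ⟦ a ℕ.* suc k ⟧                                           ≡⟨ ⟦⟧-* a (suc k) ⟩
    ⟦ a ⟧ * ⟦ suc k ⟧                                         ≡⟨ cong (_* ⟦ suc k ⟧) (sym (frac-*-cancel a b)) ⟩
    (frac a (suc b) * ⟦ suc b ⟧) * ⟦ suc k ⟧                  ≡⟨ *-assoc (frac a (suc b)) ⟦ suc b ⟧ ⟦ suc k ⟧ ⟩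
    frac a (suc b) * (⟦ suc b ⟧ * ⟦ suc k ⟧)                  ≡⟨ cong (frac a (suc b) *_) (sym (⟦⟧-* (suc b) (suc k))) ⟩
    frac a (suc b) * ⟦ suc b ℕ.* suc k ⟧                      ∎))
    where open ≡-Reasoning

  frac-monoˡ-≤ : ∀ {a b} K → a ℕ.≤ b → frac a K ≤ frac b K
  frac-monoˡ-≤ zero    _   = ≤-refl
  frac-monoˡ-≤ {a} {b} (suc k) a≤b = *-cancelʳ-≤-pos ⟦ suc k ⟧ {{⟦suc⟧-positive k}}
    (subst₂ _≤_ (sym (frac-*-cancel a k)) (sym (frac-*-cancel b k)) (⟦⟧-mono-≤ a≤b))

  frac-nonNeg : ∀ a K → 0ℚ ≤ frac a K
  frac-nonNeg a K = subst (_≤ frac a K) (frac-zero K) (frac-monoˡ-≤ K ℕ.z≤n)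

  frac-nonNegative : ∀ a K → NonNegative (frac a K)
  frac-nonNegative a K = nonNegative (frac-nonNeg a K)

  ≤-frac⇒*≤ : ∀ θ a K → θ ≤ frac a K → θ * ⟦ K ⟧ ≤ ⟦ a ⟧
  ≤-frac⇒*≤ θ a zero    _      = subst (_≤ ⟦ a ⟧) (sym (*-zeroʳ θ)) (⟦⟧-mono-≤ {0} {a} ℕ.z≤n)
  ≤-frac⇒*≤ θ a (suc k) θ≤a/K = subst (θ * ⟦ suc k ⟧ ≤_) (frac-*-cancel a k)
    (*-monoʳ-≤-nonNeg ⟦ suc k ⟧ {{⟦⟧-nonNegative (suc k)}} θ≤a/K)

module Telescoping where

  open import Data.Nat as ℕ using (ℕ; zero; suc; _∸_; _^_; z≤n; s≤s)
  import Data.Nat.Properties as ℕ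
  open import Data.Rational using (ℚ; 0ℚ; 1ℚ; ½; _*_; _≤_; _<_; NonNegative; nonNegative)
  open import Data.Rational.Properties
  open import Data.Product using (Σ; _×_; _,_)
  open import Data.Sum using (_⊎_; [_,_]′)
  open import Function using (id)
  open import Relation.Nullary using (Dec; yes; no; contradiction)
  open import Relation.Binary.PropositionalEquality
  open Fractions

  ^ℚ-+ : ∀ η a b → η ^ℚ (a ℕ.+ b) ≡ η ^ℚ a * η ^ℚ b
  ^ℚ-+ η zero    b = sym (*-identityˡ (η ^ℚ b))
  ^ℚ-+ η (suc a) b = trans (cong (η *_) (^ℚ-+ η a b)) (sym (*-assoc η (η ^ℚ a) (η ^ℚ b)))

  ^ℚ-nonNeg : ∀ {η} → 0ℚ ≤ η → ∀ m → 0ℚ ≤ η ^ℚ m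
  ^ℚ-nonNeg η≥0 zero    = ≤ᵇ⇒≤ _
  ^ℚ-nonNeg {η} η≥0 (suc m) = subst (_≤ η * η ^ℚ m) (*-zeroʳ η)
    (*-monoˡ-≤-nonNeg η {{nonNegative η≥0}} (^ℚ-nonNeg η≥0 m))

  ^ℚ-≤1 : ∀ {c} → 0ℚ ≤ c → c ≤ 1ℚ → ∀ m → c ^ℚ m ≤ 1ℚ
  ^ℚ-≤1 c≥0 c≤1 zero    = ≤-refl
  ^ℚ-≤1 {c} c≥0 c≤1 (suc m) = ≤-trans (*-monoˡ-≤-nonNeg c {{nonNegative c≥0}} (^ℚ-≤1 c≥0 c≤1 m))
    (subst (_≤ 1ℚ) (sym (*-identityʳ c)) c≤1)

  2^[1+k]∸1 : ∀ k → 2 ^ suc k ∸ 1 ≡ (2 ^ k ∸ 1) ℕ.+ 2 ^ k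
  2^[1+k]∸1 k = trans (cong (λ m → 2 ^ k ℕ.+ m ∸ 1) (ℕ.+-identityʳ (2 ^ k)))
    (ℕ.+-∸-comm (2 ^ k) (ℕ.m^n>0 2 k))

  markov-chain : ∀ {η} → 0ℚ ≤ η → ∀ i (M : ℕ → ℕ) →
    (∀ r → r ℕ.≤ i → η ^ℚ (2 ^ (i ∸ r)) * ⟦ M r ⟧ ≤ ⟦ M (suc r) ⟧) →
    ∀ k → k ℕ.≤ suc i → η ^ℚ (2 ^ k ∸ 1) * ⟦ M (suc i ∸ k) ⟧ ≤ ⟦ M (suc i) ⟧
  markov-chain η≥0 i M step zero    _ = ≤-reflexive (*-identityˡ _)
  markov-chain {η} η≥0 i M step (suc k) (s≤s k≤i) = begin
    η ^ℚ (2 ^ suc k ∸ 1) * ⟦ M (i ∸ k) ⟧               ≡⟨ cong (λ e → η ^ℚ e * ⟦ M (i ∸ k) ⟧) (2^[1+k]∸1 k) ⟩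
    η ^ℚ ((2 ^ k ∸ 1) ℕ.+ 2 ^ k) * ⟦ M (i ∸ k) ⟧       ≡⟨ cong (_* ⟦ M (i ∸ k) ⟧) (^ℚ-+ η (2 ^ k ∸ 1) (2 ^ k)) ⟩
    (η ^ℚ (2 ^ k ∸ 1) * η ^ℚ (2 ^ k)) * ⟦ M (i ∸ k) ⟧  ≡⟨ *-assoc (η ^ℚ (2 ^ k ∸ 1)) _ _ ⟩
    η ^ℚ (2 ^ k ∸ 1) * (η ^ℚ (2 ^ k) * ⟦ M (i ∸ k) ⟧)  ≤⟨ *-monoˡ-≤-nonNeg (η ^ℚ (2 ^ k ∸ 1)) {{power-nonNeg}} one-step ⟩
    η ^ℚ (2 ^ k ∸ 1) * ⟦ M (suc (i ∸ k)) ⟧             ≡⟨ cong (λ m → η ^ℚ (2 ^ k ∸ 1) * ⟦ M m ⟧) (sym (ℕ.+-∸-assoc 1 k≤i)) ⟩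
    η ^ℚ (2 ^ k ∸ 1) * ⟦ M (suc i ∸ k) ⟧               ≤⟨ markov-chain η≥0 i M step k (ℕ.m≤n⇒m≤1+n k≤i) ⟩
    ⟦ M (suc i) ⟧                                       ∎
    where
    open ≤-Reasoning
    power-nonNeg : NonNegative (η ^ℚ (2 ^ k ∸ 1))
    power-nonNeg = nonNegative (^ℚ-nonNeg η≥0 (2 ^ k ∸ 1))
    one-step : η ^ℚ (2 ^ k) * ⟦ M (i ∸ k) ⟧ ≤ ⟦ M (suc (i ∸ k)) ⟧
    one-step = subst (λ e → η ^ℚ (2 ^ e) * ⟦ M (i ∸ k) ⟧ ≤ ⟦ M (suc (i ∸ k)) ⟧) (ℕ.m∸[m∸n]≡n k≤i)
      (step (i ∸ k) (ℕ.m∸n≤m i k))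

  partialSum : (ℕ → ℕ) → ℕ → ℕ
  partialSum E zero    = 0
  partialSum E (suc k) = partialSum E k ℕ.+ E (suc k)

  telescope : ∀ i (M E : ℕ → ℕ) → M 0 ≡ 0 → (∀ r → r ℕ.≤ i → M (suc r) ℕ.≤ E (suc r) ℕ.+ M r) →
    ∀ k → k ℕ.≤ suc i → M k ℕ.≤ partialSum E k
  telescope i M E M0≡0 step zero    _ = ℕ.≤-reflexive M0≡0
  telescope i M E M0≡0 step (suc k) (s≤s k≤i) = ℕ.≤-trans (step k k≤i)
    (ℕ.≤-trans (ℕ.+-monoʳ-≤ (E (suc k)) (telescope i M E M0≡0 step k (ℕ.m≤n⇒m≤1+n k≤i)))
               (ℕ.≤-reflexive (ℕ.+-comm (E (suc k)) (partialSum E k))))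

  pigeonhole : ∀ (E : ℕ → ℕ) k → Σ ℕ λ j → j ℕ.≤ k × partialSum E (suc k) ℕ.≤ suc k ℕ.* E (suc j)
  pigeonhole E zero    = 0 , z≤n , ℕ.≤-reflexive (sym (ℕ.+-identityʳ (E 1)))
  pigeonhole E (suc k) with pigeonhole E k
  ... | j , j≤k , sum≤ with E (suc j) ℕ.≤? E (suc (suc k))
  ...   | yes Ej≤Ek+1 = suc k , ℕ.≤-refl , ℕ.≤-trans
          (ℕ.+-monoˡ-≤ (E (suc (suc k))) (ℕ.≤-trans sum≤ (ℕ.*-monoʳ-≤ (suc k) Ej≤Ek+1)))
          (ℕ.≤-reflexive (ℕ.+-comm (suc k ℕ.* E (suc (suc k))) (E (suc (suc k)))))
  ...   | no Ej≰Ek+1 = j , ℕ.m≤n⇒m≤1+n j≤k , ℕ.≤-trans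
          (ℕ.+-mono-≤ sum≤ (ℕ.<⇒≤ (ℕ.≰⇒> Ej≰Ek+1)))
          (ℕ.≤-reflexive (ℕ.+-comm (suc k ℕ.* E (suc j)) (E (suc j))))

  share-nonNegative : ∀ i M Q → NonNegative (frac 1 (suc i) * frac M Q)
  share-nonNegative i M Q = nonNeg*nonNeg⇒nonNeg (frac 1 (suc i)) {{frac-nonNegative 1 (suc i)}} (frac M Q) {{frac-nonNegative M Q}}

  nonPos-share-bound : ∀ {x} i M E Q → x ≤ 0ℚ → (x * frac 1 (suc i)) * frac M Q ≤ frac E Q
  nonPos-share-bound {x} i M E Q x≤0 = begin
    (x * frac 1 (suc i)) * frac M Q   ≡⟨ *-assoc x _ _ ⟩
    x * (frac 1 (suc i) * frac M Q)   ≤⟨ *-monoʳ-≤-nonNeg _ {{share-nonNegative i M Q}} x≤0 ⟩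
    0ℚ * (frac 1 (suc i) * frac M Q)  ≡⟨ *-zeroˡ (frac 1 (suc i) * frac M Q) ⟩
    0ℚ                                ≤⟨ frac-nonNeg E Q ⟩
    frac E Q                          ∎
    where open ≤-Reasoning

  share-bound : ∀ {x} i {M E} Q → x ≤ 1ℚ → M ℕ.≤ suc i ℕ.* E →
    (x * frac 1 (suc i)) * frac M Q ≤ frac E Q
  share-bound {x} i {M} {E} Q x≤1 M≤[i+1]E = begin
    (x * frac 1 (suc i)) * frac M Q   ≡⟨ *-assoc x _ _ ⟩
    x * (frac 1 (suc i) * frac M Q)   ≤⟨ *-monoʳ-≤-nonNeg _ {{share-nonNegative i M Q}} x≤1 ⟩
    1ℚ * (frac 1 (suc i) * frac M Q)  ≡⟨ *-identityˡ (frac 1 (suc i) * frac M Q) ⟩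
    frac 1 (suc i) * frac M Q         ≤⟨ share Q ⟩
    frac E Q                          ∎
    where
    open ≤-Reasoning
    share : ∀ Q → frac 1 (suc i) * frac M Q ≤ frac E Q
    share zero    = ≤-reflexive (*-zeroʳ (frac 1 (suc i)))
    share (suc q) = begin
      frac 1 (suc i) * frac M (suc q)     ≡⟨ *-comm (frac 1 (suc i)) _ ⟩
      frac M (suc q) * frac 1 (suc i)     ≡⟨ frac-* M 1 (suc q) i ⟩
      frac (M ℕ.* 1) (suc q ℕ.* suc i)    ≤⟨ frac-monoˡ-≤ (suc q ℕ.* suc i) M*1≤E*[i+1] ⟩
      frac (E ℕ.* suc i) (suc q ℕ.* suc i) ≡⟨ sym (frac-scale E (suc q) (suc i)) ⟩
      frac E (suc q)                       ∎
      where
      M*1≤E*[i+1] : M ℕ.* 1 ℕ.≤ E ℕ.* suc i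
      M*1≤E*[i+1] = subst₂ ℕ._≤_ (sym (ℕ.*-identityʳ M)) (ℕ.*-comm (suc i) E) M≤[i+1]E

  telescoping-pigeonhole : ∀ {η} (c : ℚ) i Q .{{_ : ℕ.NonZero Q}} (M E : ℕ → ℕ) → 0ℚ < η →
    (∀ r → r ℕ.≤ i → η ^ℚ (2 ^ (i ∸ r)) * ⟦ M r ⟧ ≤ ⟦ M (suc r) ⟧) →
    (∀ r → r ℕ.≤ i → M (suc r) ℕ.≤ E (suc r) ℕ.+ M r) →
    M 0 ≡ 0 ⊎ M 0 ≡ Q →
    frac (M (suc i)) Q < η ^ℚ (2 ^ suc i ∸ 1) →
    c ≤ ½ →
    Σ ℕ λ j → j ℕ.≤ i × ((c ^ℚ j * frac 1 (suc i)) * frac (M (suc i)) Q ≤ frac (E (suc j)) Q)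
  telescoping-pigeonhole {η} c i (suc b) M E η>0 markov step M0 M<η c≤½ = choose (0ℚ ≤? c)
    where
    M0≡0 : M 0 ≡ 0
    M0≡0 = [ id , (λ M0≡b+1 → contradiction (<-≤-trans M<η[b+1] (η[b+1]≤M M0≡b+1)) (<-irrefl refl)) ]′ M0
      where
      e = 2 ^ suc i ∸ 1
      η[b+1]≤M : M 0 ≡ suc b → η ^ℚ e * ⟦ suc b ⟧ ≤ ⟦ M (suc i) ⟧
      η[b+1]≤M M0≡b+1 = subst (λ m → η ^ℚ e * ⟦ m ⟧ ≤ ⟦ M (suc i) ⟧) (trans (cong M (ℕ.n∸n≡0 i)) M0≡b+1)
        (markov-chain (<⇒≤ η>0) i M markov (suc i) ℕ.≤-refl)
      M<η[b+1] : ⟦ M (suc i) ⟧ < η ^ℚ e * ⟦ suc b ⟧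
      M<η[b+1] = subst (_< η ^ℚ e * ⟦ suc b ⟧) (frac-*-cancel (M (suc i)) b)
        (*-monoˡ-<-pos ⟦ suc b ⟧ {{⟦suc⟧-positive b}} M<η)
    exit : Σ ℕ λ j → j ℕ.≤ i × M (suc i) ℕ.≤ suc i ℕ.* E (suc j)
    exit with pigeonhole E i
    ... | j , j≤i , sum≤ = j , j≤i , ℕ.≤-trans (telescope i M E M0≡0 step (suc i) ℕ.≤-refl) sum≤
    choose : Dec (0ℚ ≤ c) →
      Σ ℕ λ j → j ℕ.≤ i × ((c ^ℚ j * frac 1 (suc i)) * frac (M (suc i)) (suc b) ≤ frac (E (suc j)) (suc b))
    choose (yes c≥0) with exit
    ... | j , j≤i , M≤ = j , j≤i , share-bound i (suc b) (^ℚ-≤1 c≥0 (≤-trans c≤½ (≤ᵇ⇒≤ _)) j) M≤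
    -- For c < 0 an even power c^j may exceed 1; then j = 1 makes the left-hand side nonpositive.
    choose (no c≱0) with exit
    ... | zero  , j≤i , M≤ = 0 , j≤i , share-bound i (suc b) ≤-refl M≤
    ... | suc _ , j≤i , _  = 1 , ℕ.≤-trans (s≤s z≤n) j≤i ,
          nonPos-share-bound i (M (suc i)) (E 2) (suc b) (≤-trans (≤-reflexive (*-identityʳ c)) (<⇒≤ (≰⇒> c≱0)))

module Normalisation where

  import Data.Bool as Bool
  open import Data.Bool using (true; false; _∧_; not; if_then_else_; T)
  open import Data.Bool.Properties using (∧-zeroʳ; ∧-identityʳ; ∧-conicalˡ; ∧-conicalʳ)
  open import Data.Nat using (ℕ; zero; suc; _+_; _*_; _∸_; _^_; _≤_; _<_; _≡ᵇ_; _!; NonZero; >-nonZero; z≤n; s≤s)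
  open import Data.Nat.Properties
  open import Data.Vec using ([]; _∷_; lookup)
  open import Data.List using (List; []; _∷_; map; filter; length)
  open import Data.List.Properties using (map-cong)
  open import Data.Fin.Subset using (Subset; ⁅_⁆; _∪_; _─_; _-_; ∣_∣; inside; outside; ⊥)
  open import Data.Product using (proj₁; proj₂)
  open import Data.Sum using (_⊎_; inj₁; inj₂)
  open import Data.Rational as ℚ using (ℚ; 0ℚ)
  import Data.Rational.Properties as ℚ
  open import Algebra.Properties.Semiring.Sum +-*-semiring using (sum-syntax; sum-cong-≗)
  open import Algebra.Properties.CommutativeSemigroup *-commutativeSemigroup
    using () renaming (x∙yz≈yx∙z to x*[y*z]≡[y*x]*z)
  open import Function using (_∘_)
  open import Relation.Binary.PropositionalEquality
  open Counting
  open Fractions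

  sumℚ-frac : ∀ {n} (xs : List (Subset n)) (f : Subset n → ℕ) K →
    sumℚ (map (λ σ → frac (f σ) K) xs) ≡ frac (sumℕ (map f xs)) K
  sumℚ-frac []       f K = sym (frac-zero K)
  sumℚ-frac (x ∷ xs) f K = trans (cong (frac (f x) K ℚ.+_) (sumℚ-frac xs f K)) (frac-+ (f x) (sumℕ (map f xs)) K)

  *-⟦Σˢ⟧-mono : ∀ {n} (θ : ℚ) (f g : Subset n → ℕ) → (∀ p → θ ℚ.* ⟦ f p ⟧ ℚ.≤ ⟦ g p ⟧) →
    θ ℚ.* ⟦ Σˢ f ⟧ ℚ.≤ ⟦ Σˢ g ⟧
  *-⟦Σˢ⟧-mono {zero}  θ f g θf≤g = θf≤g []
  *-⟦Σˢ⟧-mono {suc n} θ f g θf≤g = subst₂ ℚ._≤_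
    (sym (trans (cong (θ ℚ.*_) (⟦⟧-+ (Σˢ (f ∘ (inside ∷_))) _)) (ℚ.*-distribˡ-+ θ _ _)))
    (sym (⟦⟧-+ (Σˢ (g ∘ (inside ∷_))) _))
    (ℚ.+-mono-≤ (*-⟦Σˢ⟧-mono θ (f ∘ (inside ∷_)) (g ∘ (inside ∷_)) (θf≤g ∘ (inside ∷_)))
                (*-⟦Σˢ⟧-mono θ (f ∘ (outside ∷_)) (g ∘ (outside ∷_)) (θf≤g ∘ (outside ∷_))))

  module PureComplex {n} (X : Family n) (d : ℕ) (isComplex : IsSimplicialComplex X)
                     (dimensional : IsDimensional X d) (pure : IsPure X d) where

    D : ℕ
    D = suc d

    open Degrees X D public

    size≤D : ∀ σ → X σ ≡ true → ∣ σ ∣ ≤ D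
    size≤D = proj₂ dimensional

    topSize≡D : topSize X ≡ D
    topSize≡D = max-allSubsets≡ sizeInX G sizeInX≤D sizeInX-G
      where
      sizeInX : Subset n → ℕ
      sizeInX σ = if X σ then ∣ σ ∣ else 0
      sizeInX≤D : ∀ σ → sizeInX σ ≤ D
      sizeInX≤D σ with X σ in Xσ
      ... | true  = size≤D σ Xσ
      ... | false = z≤n
      G = proj₁ (proj₁ dimensional)
      sizeInX-G : sizeInX G ≡ D
      sizeInX-G rewrite proj₁ (proj₂ (proj₁ dimensional)) = proj₂ (proj₂ (proj₁ dimensional))

    deg≡degree : ∀ σ → deg X σ ≡ degree σ
    deg≡degree σ rewrite topSize≡D = count≡Σˢ (λ G → top G ∧ (σ ⊆ᵇ G))

    X-?·-degree : ∀ σ → X σ ?· degree σ ≡ degree σ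
    X-?·-degree σ with X σ in Xσ
    ... | true  = refl
    ... | false = sym (Σˢ-zero no-top-face)
      where
      no-top-face : ∀ G → 𝟙 (top G ∧ (σ ⊆ᵇ G)) ≡ 0
      no-top-face G with top G in topG | σ ⊆ᵇ G in σ⊆G
      ... | true  | true  with () ← trans (sym (proj₂ isComplex G σ σ⊆G (∧-conicalˡ (X G) _ topG))) Xσ
      ... | true  | false = refl
      ... | false | _     = refl

    level-?·-deg : ∀ s σ → level X s σ ?· deg X σ ≡ ofSize s σ ?· degree σ
    level-?·-deg s σ rewrite deg≡degree σ with ofSize s σ
    ... | true  = trans (cong (_?· degree σ) (∧-identityʳ (X σ))) (X-?·-degree σ)
    ... | false = cong (_?· degree σ) (∧-zeroʳ (X σ))

    ΣS-level≡sizeMass : ∀ s → ΣS (level X s) (deg X) ≡ sizeMass s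
    ΣS-level≡sizeMass s = trans (sum-allSubsets (λ σ → level X s σ ?· deg X σ)) (Σˢ-cong (level-?·-deg s))

    norm≡frac-mass : ∀ A s → (∀ σ → A σ ≡ true → level X s σ ≡ true) → norm X s A ≡ frac (mass A) (sizeMass s)
    norm≡frac-mass A s A⊆Xs = cong₂ frac
      (trans (sum-allSubsets (λ σ → (level X s σ ∧ A σ) ?· deg X σ)) (Σˢ-cong restrict)) (ΣS-level≡sizeMass s)
      where
      restrict : ∀ σ → (level X s σ ∧ A σ) ?· deg X σ ≡ A σ ?· degree σ
      restrict σ with A σ in Aσ
      ... | true  rewrite A⊆Xs σ Aσ = deg≡degree σ
      ... | false rewrite ∧-zeroʳ (level X s σ) = refl

    norm-single : ∀ s σ → level X s σ ≡ true → norm X s (single σ) ≡ frac (degree σ) (sizeMass s)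
    norm-single s σ σ∈Xs = cong₂ frac (begin
      ΣS (λ τ → level X s τ ∧ single σ τ) (deg X)       ≡⟨ sum-allSubsets (λ τ → (level X s τ ∧ single σ τ) ?· deg X τ) ⟩
      Σˢ (λ τ → (level X s τ ∧ single σ τ) ?· deg X τ)  ≡⟨ Σˢ-cong (λ τ → ∧-?·-comm (level X s τ) (single σ τ) (deg X τ)) ⟩
      Σˢ (λ τ → single σ τ ?· level X s τ ?· deg X τ)   ≡⟨ Σˢ-single σ (λ τ → level X s τ ?· deg X τ) ⟩
      level X s σ ?· deg X σ                             ≡⟨ cong (_?· deg X σ) σ∈Xs ⟩
      deg X σ                                            ≡⟨ deg≡degree σ ⟩
      degree σ                                           ∎) (ΣS-level≡sizeMass s)
      where open ≡-Reasoning

    jointProb≡frac-exitMass : ∀ A B s → (∀ σ → A σ ≡ true → level X (suc s) σ ≡ true) →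
      jointProb X (suc s) A B ≡ frac (exitMass A B) (sizeMass (suc s) * suc s)
    jointProb≡frac-exitMass A B s A⊆Xs = begin
      jointProb X (suc s) A B
        ≡⟨ cong sumℚ (map-cong term (allSubsets n)) ⟩
      sumℚ (map (λ σ → frac (exitTerm σ) K) (allSubsets n))
        ≡⟨ sumℚ-frac (allSubsets n) exitTerm K ⟩
      frac (sumℕ (map exitTerm (allSubsets n))) K
        ≡⟨ cong (λ m → frac m K) (sum-allSubsets exitTerm) ⟩
      frac (exitMass A B) K ∎
      where
      open ≡-Reasoning
      K = sizeMass (suc s) * suc s
      exitTerm : Subset n → ℕ
      exitTerm σ = A σ ?· (degree σ * facetsOut B σ)
      term : ∀ σ → (if level X (suc s) σ ∧ A σ
                     then norm X (suc s) (single σ) ℚ.*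
                          frac (length (filter (λ v → not (B (σ - v)) Bool.≟ true) (vertices σ))) (suc s)
                     else 0ℚ)
                   ≡ frac (exitTerm σ) K
      term σ with A σ in Aσ
      ... | false rewrite ∧-zeroʳ (level X (suc s) σ) = sym (frac-zero K)
      ... | true  rewrite A⊆Xs σ Aσ | norm-single (suc s) σ (A⊆Xs σ Aσ)
                        | length-filter-vertices σ (λ v → not (B (σ - v))) =
        frac-* (degree σ) (facetsOut B σ) (sizeMass (suc s)) s

    topSize-link : ∀ σ → X σ ≡ true → topSize (link X σ) ≡ D ∸ ∣ σ ∣
    topSize-link σ Xσ = max-allSubsets≡ sizeInLink F sizeInLink≤ sizeInLink-F
      where
      sizeInLink : Subset n → ℕ
      sizeInLink τ = if link X σ τ then ∣ τ ∣ else 0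
      sizeInLink≤ : ∀ τ → sizeInLink τ ≤ D ∸ ∣ σ ∣
      sizeInLink≤ τ with link X σ τ in τ∈link
      ... | false = z≤n
      ... | true  = m+n≤o⇒m≤o∸n ∣ τ ∣ (subst (_≤ D) (∣∪∣-disjoint τ σ (∧-conicalˡ _ _ τ∈link))
                                                  (size≤D (τ ∪ σ) (∧-conicalʳ _ _ τ∈link)))
      G = proj₁ (pure σ Xσ)
      XG = proj₁ (proj₂ (pure σ Xσ))
      ∣G∣≡D = proj₁ (proj₂ (proj₂ (pure σ Xσ)))
      σ⊆G = proj₂ (proj₂ (proj₂ (pure σ Xσ)))
      F = G ─ σ
      sizeInLink-F : sizeInLink F ≡ D ∸ ∣ σ ∣
      sizeInLink-F rewrite ─-disjointᵇ G σ | ─∪-cancel σ G σ⊆G | XG =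
        trans (∣─∣≡∣∣∸∣∣ σ G σ⊆G) (cong (_∸ ∣ σ ∣) ∣G∣≡D)

    deg-link-⁅⁆ : ∀ σ v → X σ ≡ true → lookup σ v ≡ false → deg (link X σ) ⁅ v ⁆ ≡ degree (⁅ v ⁆ ∪ σ)
    deg-link-⁅⁆ σ v Xσ v∉σ rewrite topSize-link σ Xσ = begin
      count (λ F → level (link X σ) (D ∸ ∣ σ ∣) F ∧ (⁅ v ⁆ ⊆ᵇ F))
        ≡⟨ count≡Σˢ (λ F → level (link X σ) (D ∸ ∣ σ ∣) F ∧ (⁅ v ⁆ ⊆ᵇ F)) ⟩
      Σˢ (λ F → 𝟙 (level (link X σ) (D ∸ ∣ σ ∣) F ∧ (⁅ v ⁆ ⊆ᵇ F)))
        ≡⟨ Σˢ-cong in-link ⟩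
      Σˢ (λ F → disjointᵇ F σ ?· h F (F ∪ σ))
        ≡⟨ Σˢ-disjoint≡Σˢ-⊇ σ h ⟩
      Σˢ (λ G → (σ ⊆ᵇ G) ?· h (G ─ σ) G)
        ≡⟨ Σˢ-cong coface ⟩
      degree (⁅ v ⁆ ∪ σ) ∎
      where
      open ≡-Reasoning
      h : Subset n → Subset n → ℕ
      h F G = 𝟙 ((X G ∧ (∣ F ∣ ≡ᵇ D ∸ ∣ σ ∣)) ∧ (⁅ v ⁆ ⊆ᵇ F))
      in-link : ∀ F → 𝟙 (level (link X σ) (D ∸ ∣ σ ∣) F ∧ (⁅ v ⁆ ⊆ᵇ F)) ≡ disjointᵇ F σ ?· h F (F ∪ σ)
      in-link F with disjointᵇ F σ
      ... | true  = refl
      ... | false = refl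
      coface : ∀ G → (σ ⊆ᵇ G) ?· h (G ─ σ) G ≡ 𝟙 (top G ∧ ((⁅ v ⁆ ∪ σ) ⊆ᵇ G))
      coface G rewrite ⁅⁆∪-⊆ᵇ v σ G | ⁅⁆-⊆ᵇ v (G ─ σ) | lookup-─ G σ v | v∉σ | ∧-identityʳ (lookup G v)
        with σ ⊆ᵇ G in σ⊆G
      ... | false rewrite ∧-zeroʳ (lookup G v) | ∧-zeroʳ (top G) = refl
      ... | true  rewrite ∧-identityʳ (lookup G v) = cong (λ b → 𝟙 ((X G ∧ b) ∧ lookup G v)) (begin
        (∣ G ─ σ ∣ ≡ᵇ D ∸ ∣ σ ∣)                        ≡⟨ sym (≡ᵇ-+-cancelʳ (∣ G ─ σ ∣) (D ∸ ∣ σ ∣) (∣ σ ∣)) ⟩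
        (∣ G ─ σ ∣ + ∣ σ ∣ ≡ᵇ (D ∸ ∣ σ ∣) + ∣ σ ∣)      ≡⟨ cong₂ _≡ᵇ_ (∣─∣+∣∣ σ G σ⊆G) (m∸n+n≡m (size≤D σ Xσ)) ⟩
        (∣ G ∣ ≡ᵇ D)                                    ∎)

    ΣS-localize≡upperMass : ∀ A σ → X σ ≡ true → (∀ τ → A τ ≡ true → X τ ≡ true) →
      ΣS (λ ρ → level (link X σ) 1 ρ ∧ localize X A σ ρ) (deg (link X σ)) ≡ upperMass A σ
    ΣS-localize≡upperMass A σ Xσ A⊆X = begin
      ΣS (λ ρ → level L 1 ρ ∧ localize X A σ ρ) (deg L)
        ≡⟨ sum-allSubsets (λ ρ → (level L 1 ρ ∧ localize X A σ ρ) ?· deg L ρ) ⟩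
      Σˢ (λ ρ → (level L 1 ρ ∧ localize X A σ ρ) ?· deg L ρ)
        ≡⟨ Σˢ-cong (λ ρ → vertex-in-link (L ρ) (∣ ρ ∣ ≡ᵇ 1) (A (ρ ∪ σ)) (deg L ρ)) ⟩
      Σˢ (λ ρ → (∣ ρ ∣ ≡ᵇ 1) ?· (L ρ ∧ A (ρ ∪ σ)) ?· deg L ρ)
        ≡⟨ Σˢ-size-1 (λ ρ → (L ρ ∧ A (ρ ∪ σ)) ?· deg L ρ) ⟩
      ∑[ v < n ] ((L ⁅ v ⁆ ∧ A (⁅ v ⁆ ∪ σ)) ?· deg L ⁅ v ⁆)
        ≡⟨ sum-cong-≗ extension ⟩
      upperMass A σ ∎
      where
      open ≡-Reasoning
      L = link X σ
      vertex-in-link : ∀ l s a x → ((l ∧ s) ∧ (l ∧ a)) ?· x ≡ s ?· (l ∧ a) ?· x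
      vertex-in-link true  true  a x = refl
      vertex-in-link true  false a x = refl
      vertex-in-link false true  a x = refl
      vertex-in-link false false a x = refl
      extension : ∀ v → (L ⁅ v ⁆ ∧ A (⁅ v ⁆ ∪ σ)) ?· deg L ⁅ v ⁆
                        ≡ not (lookup σ v) ?· A (⁅ v ⁆ ∪ σ) ?· degree (⁅ v ⁆ ∪ σ)
      extension v rewrite ⁅⁆-disjointᵇ v σ with lookup σ v in σv | A (⁅ v ⁆ ∪ σ) in Aσv
      ... | true  | _     = refl
      ... | false | false = cong (_?· deg L ⁅ v ⁆) (∧-zeroʳ (X (⁅ v ⁆ ∪ σ)))
      ... | false | true  rewrite A⊆X _ Aσv = deg-link-⁅⁆ σ v Xσ σv

    ΣS-link-vertices : ∀ σ → X σ ≡ true → ΣS (level (link X σ) 1) (deg (link X σ)) ≡ (D ∸ ∣ σ ∣) * degree σ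
    ΣS-link-vertices σ Xσ = begin
      ΣS (level L 1) (deg L)                                  ≡⟨ sum-allSubsets (λ ρ → level L 1 ρ ?· deg L ρ) ⟩
      Σˢ (λ ρ → level L 1 ρ ?· deg L ρ)                       ≡⟨ Σˢ-cong (λ ρ → ∧-?·-comm (L ρ) (∣ ρ ∣ ≡ᵇ 1) (deg L ρ)) ⟩
      Σˢ (λ ρ → (∣ ρ ∣ ≡ᵇ 1) ?· L ρ ?· deg L ρ)               ≡⟨ Σˢ-size-1 (λ ρ → L ρ ?· deg L ρ) ⟩
      ∑[ v < n ] (L ⁅ v ⁆ ?· deg L ⁅ v ⁆)                     ≡⟨ sum-cong-≗ vertex ⟩
      ∑[ v < n ] (not (lookup σ v) ?· degree (⁅ v ⁆ ∪ σ))     ≡⟨ ∑-degree-extensions σ ⟩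
      (D ∸ ∣ σ ∣) * degree σ                                  ∎
      where
      open ≡-Reasoning
      L = link X σ
      vertex : ∀ v → L ⁅ v ⁆ ?· deg L ⁅ v ⁆ ≡ not (lookup σ v) ?· degree (⁅ v ⁆ ∪ σ)
      vertex v rewrite ⁅⁆-disjointᵇ v σ with lookup σ v in σv
      ... | true  = refl
      ... | false rewrite deg-link-⁅⁆ σ v Xσ σv = X-?·-degree (⁅ v ⁆ ∪ σ)

    localNorm≡frac-upperMass : ∀ A r σ → X σ ≡ true → ∣ σ ∣ ≡ r → (∀ τ → A τ ≡ true → X τ ≡ true) →
      localNorm X (suc r) A σ ≡ frac (upperMass A σ) ((D ∸ ∣ σ ∣) * degree σ)
    localNorm≡frac-upperMass A r σ Xσ ∣σ∣≡r A⊆X = trans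
      (cong (λ s → norm (link X σ) s (localize X A σ)) (trans (cong (suc r ∸_) ∣σ∣≡r) (m+n∸n≡m 1 r)))
      (cong₂ frac (ΣS-localize≡upperMass A σ Xσ A⊆X) (ΣS-link-vertices σ Xσ))

    sizeMass-0 : sizeMass 0 ≡ degree ⊥
    sizeMass-0 = Σˢ-size-0 degree

    sizeMass-0-positive : 1 ≤ sizeMass 0
    sizeMass-0-positive = subst (1 ≤_) (sym sizeMass-0) (subst (_≤ degree ⊥) G-top (term≤Σˢ _ G))
      where
      G = proj₁ (proj₁ dimensional)
      G-top : 𝟙 (top G ∧ (⊥ ⊆ᵇ G)) ≡ 1
      G-top rewrite proj₁ (proj₂ (proj₁ dimensional)) | proj₂ (proj₂ (proj₁ dimensional)) | ≡ᵇ-refl d | ⊥-⊆ᵇ G = refl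

    mass-size-0 : ∀ A → HasSize A 0 → mass A ≡ A ⊥ ?· sizeMass 0
    mass-size-0 A A⊆0 = begin
      mass A                                        ≡⟨ Σˢ-cong only-⊥ ⟩
      Σˢ (λ σ → (∣ σ ∣ ≡ᵇ 0) ?· A σ ?· degree σ)   ≡⟨ Σˢ-size-0 (λ σ → A σ ?· degree σ) ⟩
      A ⊥ ?· degree ⊥                               ≡⟨ cong (A ⊥ ?·_) (sym sizeMass-0) ⟩
      A ⊥ ?· sizeMass 0                             ∎
      where
      open ≡-Reasoning
      only-⊥ : ∀ σ → A σ ?· degree σ ≡ (∣ σ ∣ ≡ᵇ 0) ?· A σ ?· degree σ
      only-⊥ σ with A σ in Aσ
      ... | true  rewrite A⊆0 σ Aσ = refl
      ... | false = sym (?·-zeroʳ (∣ σ ∣ ≡ᵇ 0))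

    module FatFaces (i : ℕ) (η : ℚ) (W : Family n) (i<d : i < d)
                    (W⊆Xi : ∀ σ → W σ ≡ true → level X (suc i) σ ≡ true) where

      Fat : ℕ → Family n
      Fat s = S X η i W s

      Fat-top : Fat (suc i) ≡ W
      Fat-top = cong (fat X η i W) (n∸n≡0 i)

      Fat-below : ∀ r → r ≤ i → Fat r ≡ fat X η i W (suc (i ∸ r))
      Fat-below r r≤i = cong (fat X η i W) (+-∸-assoc 1 r≤i)

      Fat⊆level : ∀ s → s ≤ suc i → ∀ σ → Fat s σ ≡ true → level X s σ ≡ true
      Fat⊆level s s≤i+1 σ σ∈Fat with m≤n⇒m<n∨m≡n s≤i+1
      ... | inj₂ refl        = W⊆Xi σ (subst (λ A → A σ ≡ true) Fat-top σ∈Fat)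
      ... | inj₁ (s≤s s≤i) = subst (λ t → level X t σ ≡ true) (m∸[m∸n]≡n s≤i)
          (∧-conicalˡ _ _ (subst (λ A → A σ ≡ true) (Fat-below s s≤i) σ∈Fat))

      Fat-size : ∀ s → s ≤ suc i → HasSize (Fat s) s
      Fat-size s s≤i+1 σ σ∈Fat = ≡ᵇ-true⇒≡ (∧-conicalʳ (X σ) _ (Fat⊆level s s≤i+1 σ σ∈Fat))

      Fat⊆X : ∀ s → s ≤ suc i → ∀ σ → Fat s σ ≡ true → X σ ≡ true
      Fat⊆X s s≤i+1 σ σ∈Fat = ∧-conicalˡ (X σ) _ (Fat⊆level s s≤i+1 σ σ∈Fat)

      threshold : ℕ → ℚ
      threshold r = η ^ℚ (2 ^ (i ∸ r))

      threshold≤localNorm : ∀ r → r ≤ i → ∀ σ → Fat r σ ≡ true →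
        threshold r ℚ.≤ localNorm X (suc r) (Fat (suc r)) σ
      threshold≤localNorm r r≤i σ σ∈Fat = subst (λ s → threshold r ℚ.≤ localNorm X s (Fat (suc r)) σ) size
        (ℚ.≤ᵇ⇒≤ (subst T (sym (∧-conicalʳ (level X (i ∸ (i ∸ r)) σ) _ σ∈fat)) _))
        where
        σ∈fat : fat X η i W (suc (i ∸ r)) σ ≡ true
        σ∈fat = subst (λ A → A σ ≡ true) (Fat-below r r≤i) σ∈Fat
        size : suc i ∸ (i ∸ r) ≡ suc r
        size = trans (+-∸-assoc 1 (m∸n≤m i r)) (cong suc (m∸[m∸n]≡n r≤i))

      markov-mass : ∀ r → r ≤ i →
        threshold r ℚ.* ⟦ (D ∸ r) * mass (Fat r) ⟧ ℚ.≤ ⟦ suc r * mass (Fat (suc r)) ⟧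
      markov-mass r r≤i = begin
        threshold r ℚ.* ⟦ (D ∸ r) * mass (Fat r) ⟧
          ≡⟨ cong (λ m → threshold r ℚ.* ⟦ m ⟧) (sym (Σˢ-?·-≡-* (Fat r) (D ∸ r) scale)) ⟩
        threshold r ℚ.* ⟦ Σˢ (λ σ → Fat r σ ?· ((D ∸ ∣ σ ∣) * degree σ)) ⟧
          ≤⟨ *-⟦Σˢ⟧-mono (threshold r) _ _ local ⟩
        ⟦ Σˢ (λ σ → Fat r σ ?· upperMass (Fat (suc r)) σ) ⟧
          ≤⟨ ⟦⟧-mono-≤ (Σˢ-mono-≤ (λ σ → ?·-≤ (Fat r σ) _)) ⟩
        ⟦ Σˢ (upperMass (Fat (suc r))) ⟧
          ≡⟨ cong ⟦_⟧ (Σˢ-upperMass (Fat (suc r)) r (Fat-size (suc r) (s≤s r≤i))) ⟩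
        ⟦ suc r * mass (Fat (suc r)) ⟧ ∎
        where
        open ℚ.≤-Reasoning
        r≤i+1 = m≤n⇒m≤1+n r≤i
        scale : ∀ σ → Fat r σ ≡ true → (D ∸ ∣ σ ∣) * degree σ ≡ (D ∸ r) * degree σ
        scale σ σ∈Fat = cong (λ s → (D ∸ s) * degree σ) (Fat-size r r≤i+1 σ σ∈Fat)
        local : ∀ σ → threshold r ℚ.* ⟦ Fat r σ ?· ((D ∸ ∣ σ ∣) * degree σ) ⟧
                      ℚ.≤ ⟦ Fat r σ ?· upperMass (Fat (suc r)) σ ⟧
        local σ with Fat r σ in σ∈Fat
        ... | false = ℚ.≤-reflexive (ℚ.*-zeroʳ (threshold r))
        ... | true  = ≤-frac⇒*≤ (threshold r) (upperMass (Fat (suc r)) σ) ((D ∸ ∣ σ ∣) * degree σ)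
          (subst (threshold r ℚ.≤_)
            (localNorm≡frac-upperMass (Fat (suc r)) r σ (Fat⊆X r r≤i+1 σ σ∈Fat) (Fat-size r r≤i+1 σ σ∈Fat)
                                      (Fat⊆X (suc r) (s≤s r≤i)))
            (threshold≤localNorm r r≤i σ σ∈Fat))

      Q : ℕ
      Q = sizeMass 0 * weight 0

      instance
        Q-nonZero : NonZero Q
        Q-nonZero = m*n≢0 (sizeMass 0) (weight 0) {{>-nonZero sizeMass-0-positive}} {{0 !* D !≢0}}

      M : ℕ → ℕ
      M s = mass (Fat s) * weight s

      E : ℕ → ℕ
      E zero    = 0
      E (suc r) = exitMass (Fat (suc r)) (Fat r) * stepWeight r

      r<D : ∀ {r} → r ≤ i → suc r ≤ D
      r<D r≤i = s≤s (≤-trans r≤i (<⇒≤ i<d))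

      M-below : ∀ r → r ≤ i → M r ≡ ((D ∸ r) * mass (Fat r)) * stepWeight r
      M-below r r≤i = trans (cong (mass (Fat r) *_) (weight-≡-∸ r (r<D r≤i)))
                            (x*[y*z]≡[y*x]*z (mass (Fat r)) (D ∸ r) (stepWeight r))

      M-above : ∀ r → M (suc r) ≡ (suc r * mass (Fat (suc r))) * stepWeight r
      M-above r = trans (cong (mass (Fat (suc r)) *_) (weight-suc r))
                        (x*[y*z]≡[y*x]*z (mass (Fat (suc r))) (suc r) (stepWeight r))

      markov : ∀ r → r ≤ i → threshold r ℚ.* ⟦ M r ⟧ ℚ.≤ ⟦ M (suc r) ⟧
      markov r r≤i = subst₂ ℚ._≤_
        (begin-equality
          (threshold r ℚ.* ⟦ (D ∸ r) * mass (Fat r) ⟧) ℚ.* ⟦ stepWeight r ⟧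
            ≡⟨ ℚ.*-assoc (threshold r) _ _ ⟩
          threshold r ℚ.* (⟦ (D ∸ r) * mass (Fat r) ⟧ ℚ.* ⟦ stepWeight r ⟧)
            ≡⟨ cong (threshold r ℚ.*_) (sym (⟦⟧-* ((D ∸ r) * mass (Fat r)) (stepWeight r))) ⟩
          threshold r ℚ.* ⟦ ((D ∸ r) * mass (Fat r)) * stepWeight r ⟧
            ≡⟨ cong (λ m → threshold r ℚ.* ⟦ m ⟧) (sym (M-below r r≤i)) ⟩
          threshold r ℚ.* ⟦ M r ⟧ ∎)
        (trans (sym (⟦⟧-* (suc r * mass (Fat (suc r))) (stepWeight r))) (cong ⟦_⟧ (sym (M-above r))))
        (ℚ.*-monoʳ-≤-nonNeg ⟦ stepWeight r ⟧ {{⟦⟧-nonNegative (stepWeight r)}} (markov-mass r r≤i))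
        where open ℚ.≤-Reasoning

      exit-step : ∀ r → r ≤ i → M (suc r) ≤ E (suc r) + M r
      exit-step r r≤i = subst₂ _≤_ (sym (M-above r))
        (trans (*-distribʳ-+ (stepWeight r) (exitMass (Fat (suc r)) (Fat r)) _) (cong (E (suc r) +_) (sym (M-below r r≤i))))
        (*-monoˡ-≤ (stepWeight r)
          (exitMass-bound (Fat (suc r)) (Fat r) r (Fat-size (suc r) (s≤s r≤i)) (Fat-size r (m≤n⇒m≤1+n r≤i))))

      M-0 : M 0 ≡ 0 ⊎ M 0 ≡ Q
      M-0 rewrite mass-size-0 (Fat 0) (Fat-size 0 z≤n) with Fat 0 ⊥
      ... | false = inj₁ refl
      ... | true  = inj₂ refl

      rescale : ∀ a s → s ≤ D → frac a (sizeMass s) ≡ frac (a * weight s) Q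
      rescale a s s≤D = trans (frac-scale a (sizeMass s) (weight s) {{s !* (D ∸ s) !≢0}})
                              (cong (frac (a * weight s)) (sizeMass-weight s s≤D))

      norm≡frac-M : norm X (suc i) W ≡ frac (M (suc i)) Q
      norm≡frac-M = begin
        norm X (suc i) W                            ≡⟨ cong (norm X (suc i)) (sym Fat-top) ⟩
        norm X (suc i) (Fat (suc i))                ≡⟨ norm≡frac-mass (Fat (suc i)) (suc i) (Fat⊆level (suc i) ≤-refl) ⟩
        frac (mass (Fat (suc i))) (sizeMass (suc i)) ≡⟨ rescale (mass (Fat (suc i))) (suc i) (r<D ≤-refl) ⟩
        frac (M (suc i)) Q                          ∎
        where open ≡-Reasoning

      jointProb≡frac-E : ∀ j → j ≤ i → jointProb X (suc j) (Fat (suc j)) (Fat j) ≡ frac (E (suc j)) Q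
      jointProb≡frac-E j j≤i = begin
        jointProb X (suc j) (Fat (suc j)) (Fat j)
          ≡⟨ jointProb≡frac-exitMass (Fat (suc j)) (Fat j) j (Fat⊆level (suc j) (s≤s j≤i)) ⟩
        frac (exitMass (Fat (suc j)) (Fat j)) (sizeMass (suc j) * suc j)
          ≡⟨ frac-scale (exitMass (Fat (suc j)) (Fat j)) (sizeMass (suc j) * suc j) (stepWeight j) {{j !* (D ∸ suc j) !≢0}} ⟩
        frac (E (suc j)) ((sizeMass (suc j) * suc j) * stepWeight j)
          ≡⟨ cong (frac (E (suc j))) (trans (*-assoc (sizeMass (suc j)) (suc j) (stepWeight j))
                                            (cong (sizeMass (suc j) *_) (sym (weight-suc j)))) ⟩
        frac (E (suc j)) (sizeMass (suc j) * weight (suc j))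
          ≡⟨ cong (frac (E (suc j))) (sizeMass-weight (suc j) (r<D j≤i)) ⟩
        frac (E (suc j)) Q ∎
        where open ≡-Reasoning

open import Data.Nat using (ℕ; suc; _≤_; _<_; _^_; _∸_)
open import Data.Rational using (ℚ; 0ℚ; 1ℚ; ½; _*_) renaming (_<_ to _<ℚ_; _≤_ to _≤ℚ_)
open import Data.Product using (Σ; _×_; _,_)
open import Data.Bool using (true)
open import Data.Fin.Subset using (Subset)
open import Relation.Binary.PropositionalEquality using (_≡_; sym; cong; subst; subst₂)
open Telescoping using (telescoping-pigeonhole)
open Normalisation using (module PureComplex)

proposition2p6 : ∀ {n} (X : Family n) (d i : ℕ) (η : ℚ) →
    IsSimplicialComplex X → IsDimensional X d → IsPure X d →
    i < d → 0ℚ <ℚ η → η <ℚ 1ℚ →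
    ∀ (W : Family n) → (∀ (σ : Subset n) → W σ ≡ true → level X (suc i) σ ≡ true) →
    norm X (suc i) W <ℚ η ^ℚ (2 ^ suc i ∸ 1) →
    ∀ (c : ℚ) → c ≤ℚ ½ →
    Σ ℕ λ j → (j ≤ i) ×
      (((c ^ℚ j) * frac 1 (suc i)) * norm X (suc i) W
        ≤ℚ jointProb X (suc j) (S X η i W (suc j)) (S X η i W j))
proposition2p6 X d i η isComplex dimensional pure i<d η>0 _ W W⊆Xi small c c≤½ =
  let j , j≤i , bound = telescoping-pigeonhole c i Q M E η>0 markov exit-step M-0 small-M c≤½
  in j , j≤i , subst₂ _≤ℚ_ (cong ((c ^ℚ j) * frac 1 (suc i) *_) (sym norm≡frac-M))
                           (sym (jointProb≡frac-E j j≤i)) bound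
  where
  open PureComplex X d isComplex dimensional pure
  open FatFaces i η W i<d W⊆Xi
  small-M : frac (M (suc i)) Q <ℚ η ^ℚ (2 ^ suc i ∸ 1)
  small-M = subst (_<ℚ η ^ℚ (2 ^ suc i ∸ 1)) norm≡frac-M small
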